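{- Let $A$ be a formula of classical propositional logic built from literals using $\wedge$ and $\vee$. Then $A$ is valid (true under every truth assignment to its variables) if and only if $A$ has a combinatorial proof, i.e. there exist a formula $A'$ (built from literals using $\wedge$ and $\vee$), an MLL proof net on $A'$, and a label- and clique-preserving function from the leaves of $A'$ to the leaves of $A$.
   Context: Formulas are built from literals (propositional variables $P,Q,\ldots$ and their negations $\overline{P},\overline{Q},\ldots$) using binary $\wedge$ and $\vee$; implication is treated as an abbreviation, $X\Rightarrow Y$ meaning $\overline{X}\vee Y$ with negation pushed to the literals by De Morgan's laws. A formula is identified with its parse tree: a tree whose leaves are labelled by literals and whose internal vertices are labelled $\wedge$ or $\vee$; distinct occurrences of the same literal are distinct leaves. A $\vee$-resolution of a formula $A$ is any result of deleting, at each $\vee$-vertex of the parse tree, one of its two argument subtrees. A set $L$ of leaves of $A$ is a clique of $A$ if $L$ is the set of leaves of some $\vee$-resolution of $A$. A function $f$ from the leaves of $A'$ to the leaves of $A$ is label-preserving if each leaf and its image carry the same literal, and clique-preserving if the image under $f$ of every clique of $A'$ is a clique of $A$. An MLL proof net on $A'$ is obtained by reading $A'$ as a formula of multiplicative linear logic ($\wedge$ as tensor, $\vee$ as par) and giving a set of axiom links, i.e. a partition of the leaves of $A'$ into pairs each consisting of a leaf labelled $P$ and a leaf labelled $\overline{P}$ for some variable $P$, such that the standard (Danos–Regnier) correctness criterion holds: for every switching (choosing, at each $\vee$-vertex, exactly one of the two edges to its arguments, and keeping all edges at $\wedge$-vertices), the undirected graph formed by the parse tree edges so chosen together with the axiom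 links is connected and acyclic. -}

module Defs where

open import Data.Nat using (ℕ; _≤_)
open import Data.Bool using (Bool; true; false; not; if_then_else_; _∧_; _∨_)
open import Data.Unit using (⊤; tt)
open import Data.Empty using (⊥)
open import Data.Product using (Σ; Σ-syntax; ∃; ∃-syntax; _×_; _,_)
open import Data.Sum using (_⊎_; inj₁; inj₂)
open import Data.List using (List; []; _∷_; _++_; [_]; length)
open import Data.List.Relation.Unary.Unique.Propositional using (Unique)
open import Data.List.Relation.Unary.Linked using (Linked)
open import Relation.Binary.Construct.Closure.ReflexiveTransitive using (Star)
open import Relation.Binary.PropositionalEquality using (_≡_)
open import Relation.Nullary using (¬_)
open import Function.Bundles using (_⇔_)
open import Level using (Level)

-- A literal: a propositional variable (indexed by ℕ) with a polarity;
-- pos = true is P, pos = false is the negation P̄.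
record Lit : Set where
  constructor mkLit
  field
    var : ℕ
    pos : Bool
open Lit public

dual : Lit → Lit
dual (mkLit x b) = mkLit x (not b)

data Formula : Set where
  lit  : Lit → Formula
  _∧ᶠ_ : Formula → Formula → Formula
  _∨ᶠ_ : Formula → Formula → Formula

infixr 6 _∧ᶠ_
infixr 5 _∨ᶠ_

Valuation : Set
Valuation = ℕ → Bool

evalLit : Valuation → Lit → Bool
evalLit v (mkLit x b) = if b then v x else not (v x)

eval : Valuation → Formula → Bool
eval v (lit l)   = evalLit v l
eval v (A ∧ᶠ B) = eval v A ∧ eval v B
eval v (A ∨ᶠ B) = eval v A ∨ eval v B

Valid : Formula → Set
Valid A = ∀ (v : Valuation) → eval v A ≡ true

data Leaf : Formula → Set where
  here : ∀ {l} → Leaf (lit l)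
  ∧l : ∀ {A B} → Leaf A → Leaf (A ∧ᶠ B)
  ∧r : ∀ {A B} → Leaf B → Leaf (A ∧ᶠ B)
  ∨l : ∀ {A B} → Leaf A → Leaf (A ∨ᶠ B)
  ∨r : ∀ {A B} → Leaf B → Leaf (A ∨ᶠ B)

label : ∀ {A} → Leaf A → Lit
label {lit l} here = l
label (∧l x) = label x
label (∧r x) = label x
label (∨l x) = label x
label (∨r x) = label x

data Node : Formula → Set where
  root : ∀ {A} → Node A
  ∧l : ∀ {A B} → Node A → Node (A ∧ᶠ B)
  ∧r : ∀ {A B} → Node B → Node (A ∧ᶠ B)
  ∨l : ∀ {A B} → Node A → Node (A ∨ᶠ B)
  ∨r : ∀ {A B} → Node B → Node (A ∨ᶠ B)

leafNode : ∀ {A} → Leaf A → Node A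
leafNode here = root
leafNode (∧l x) = ∧l (leafNode x)
leafNode (∧r x) = ∧r (leafNode x)
leafNode (∨l x) = ∨l (leafNode x)
leafNode (∨r x) = ∨r (leafNode x)

-- A ∨-resolution: at each ∨-vertex choose which argument to keep
-- (inj₁ = keep left, inj₂ = keep right).
Resolution : Formula → Set
Resolution (lit l)  = ⊤
Resolution (A ∧ᶠ B) = Resolution A × Resolution B
Resolution (A ∨ᶠ B) = Resolution A ⊎ Resolution B

data InRes : (A : Formula) → Resolution A → Leaf A → Set where
  here : ∀ {l} → InRes (lit l) tt here
  ∧l : ∀ {A B r s x} → InRes A r x → InRes (A ∧ᶠ B) (r , s) (∧l x)
  ∧r : ∀ {A B r s y} → InRes B s y → InRes (A ∧ᶠ B) (r , s) (∧r y)
  ∨l : ∀ {A B r x} → InRes A r x → InRes (A ∨ᶠ B) (inj₁ r) (∨l x)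
  ∨r : ∀ {A B s y} → InRes B s y → InRes (A ∨ᶠ B) (inj₂ s) (∨r y)

-- A set of leaves (as a predicate) is a clique if it is the leaf set of
-- some ∨-resolution.
IsClique : (A : Formula) → (Leaf A → Set) → Set
IsClique A L = Σ[ r ∈ Resolution A ] (∀ x → L x ⇔ InRes A r x)

image : ∀ {A A'} → (Leaf A' → Leaf A) → (Leaf A' → Set) → Leaf A → Set
image f L y = Σ[ x ∈ _ ] (L x × f x ≡ y)

LabelPreserving : ∀ {A A'} → (Leaf A' → Leaf A) → Set
LabelPreserving f = ∀ x → label (f x) ≡ label x

CliquePreserving : ∀ {A A'} → (Leaf A' → Leaf A) → Set₁
CliquePreserving {A} {A'} f =
  ∀ (L : Leaf A' → Set) → IsClique A' L → IsClique A (image f L)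

-- A switching: at each ∨ (par) vertex choose one of its two argument edges
-- (true = left edge, false = right edge).
Switching : Formula → Set
Switching (lit l)  = ⊤
Switching (A ∧ᶠ B) = Switching A × Switching B
Switching (A ∨ᶠ B) = Bool × Switching A × Switching B

-- Parse-tree edges kept by a switching (directed parent → child).
data TEdge : (A : Formula) → Switching A → Node A → Node A → Set where
  ∧-left  : ∀ {A B s t} → TEdge (A ∧ᶠ B) (s , t) root (∧l root)
  ∧-right : ∀ {A B s t} → TEdge (A ∧ᶠ B) (s , t) root (∧r root)
  ∨-left  : ∀ {A B s t} → TEdge (A ∨ᶠ B) (true , s , t) root (∨l root)
  ∨-right : ∀ {A B s t} → TEdge (A ∨ᶠ B) (false , s , t) root (∨r root)
  ∧l : ∀ {A B s t u v} → TEdge A s u v → TEdge (A ∧ᶠ B) (s , t) (∧l u) (∧l v)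
  ∧r : ∀ {A B s t u v} → TEdge B t u v → TEdge (A ∧ᶠ B) (s , t) (∧r u) (∧r v)
  ∨l : ∀ {A B b s t u v} → TEdge A s u v → TEdge (A ∨ᶠ B) (b , s , t) (∨l u) (∨l v)
  ∨r : ∀ {A B b s t u v} → TEdge B t u v → TEdge (A ∨ᶠ B) (b , s , t) (∨r u) (∨r v)

-- Axiom linkings: a partition of the leaves into pairs {P, P̄}, given as
-- an involution pairing each leaf with a dually labelled leaf.
record AxiomLinking (A : Formula) : Set where
  field
    link      : Leaf A → Leaf A
    involutive : ∀ x → link (link x) ≡ x
    dualLabel : ∀ x → label (link x) ≡ dual (label x)

Adj : ∀ {A} → AxiomLinking A → Switching A → Node A → Node A → Set
Adj {A} ax s u v =
  TEdge A s u v ⊎ TEdge A s v u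
  ⊎ Σ[ x ∈ Leaf A ] (u ≡ leafNode x × v ≡ leafNode (AxiomLinking.link ax x))

Connected : ∀ {V : Set} → (V → V → Set) → Set
Connected E = ∀ u v → Star E u v

IsCycle : ∀ {V : Set} → (V → V → Set) → List V → Set
IsCycle E []       = ⊥
IsCycle E (v ∷ vs) =
  3 ≤ length (v ∷ vs) × Unique (v ∷ vs) × Linked E ((v ∷ vs) ++ [ v ])

Acyclic : ∀ {V : Set} → (V → V → Set) → Set
Acyclic {V} E = ¬ (Σ[ c ∈ List V ] IsCycle E c)

-- An MLL proof net on A': an axiom linking satisfying the Danos–Regnier
-- correctness criterion.
record ProofNet (A : Formula) : Set where
  field
    axioms  : AxiomLinking A
    correct : ∀ (s : Switching A) →
              Connected (Adj axioms s) × Acyclic (Adj axioms s)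

CombinatorialProof : Formula → Set₁
CombinatorialProof A =
  Σ[ A' ∈ Formula ] Σ[ net ∈ ProofNet A' ] Σ[ f ∈ (Leaf A' → Leaf A) ]
    (LabelPreserving f × CliquePreserving f)

module Submission where

-- A valuation falsifying A′ picks, at every ∧-vertex, a false argument; the resulting ∧-resolution
-- of A′ has only false leaves, so each of its leaves is linked to a true leaf outside it. Walk from the root:
-- inside the resolution go down (left at ∨), leave it along axiom links, outside it climb towards the root.
-- This walk never stops, and its first repetition is a cycle of a switching graph (switch the ∨-vertices
-- outside the resolution towards the side the cycle climbs from), contradicting correctness. So A′ is valid,
-- and a clique-preserving map transports validity, because the true leaves of A′ contain a clique.
--
-- Proof search for the one-sided sequent calculus with rules for literals, ∨ and ∧ builds a
-- net with several conclusions rule by rule (axiom link, par, tensor), keeping for each conclusion a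
-- label- and clique-preserving map onto the formula of the sequent it comes from. At an ∧-rule the
-- conclusions mapped onto the same formula are first joined by ∨: this is where contraction happens.

open import Defs
open import Data.Nat using (ℕ; zero; suc; pred; _+_; _≤_; _<_; z≤n; s≤s; anyUpTo?)
import Data.Nat as ℕ
open import Data.Nat.Properties
  using (≤-refl; ≤-trans; ≤-pred; <-trans; <-irrefl; <-cmp; 1+n≢n; n<1+n; +-suc; +-comm; +-assoc; +-identityʳ;
         +-monoˡ-≤; +-monoʳ-<; m≤m+n; m≤n+m; m<1+n⇒m<n∨m≡n; m≤n⇒∃[o]m+o≡n)
open import Data.Bool using (Bool; true; false; not; if_then_else_; _∧_; _∨_)
import Data.Bool as Bool
open import Data.Bool.Properties using (not-involutive; ∨-zeroʳ)
open import Data.Unit using (⊤; tt)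
open import Data.Empty using (⊥; ⊥-elim)
open import Data.Maybe using (Maybe; just; nothing)
import Data.Maybe as Maybe
open import Data.Maybe.Properties using (just-injective)
open import Data.Product using (Σ-syntax; ∃-syntax; _×_; _,_; proj₂)
import Data.Product as ×
open import Data.Sum using (_⊎_; inj₁; inj₂)
import Data.Sum as ⊎
open import Data.Sum.Properties using (swap-involutive)
open import Data.Fin using (toℕ)
open import Data.Fin.Properties using (pigeonhole)
open import Data.List using (List; []; _∷_; _++_; [_]; length; map; lookup; applyUpTo)
open import Data.List.Properties using (length-map; map-++; ++-assoc; length-applyUpTo; applyUpTo-∷ʳ)
open import Data.List.Relation.Unary.All using (All; []; _∷_)
open import Data.List.Relation.Unary.AllPairs using (_∷_)
open import Data.List.Relation.Unary.Any using (Any; here; there; index; any?)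
open import Data.List.Relation.Unary.Any.Properties using (lookup-index)
open import Data.List.Membership.Propositional using (_∈_; _∉_; find; lose)
open import Data.List.Membership.Propositional.Properties
  using (∈-∃++; ∈-map⁺; ∈-++⁺ˡ; ∈-++⁺ʳ; ∈-applyUpTo⁻; ∈-applyUpTo⁺)
open import Data.List.Relation.Unary.Linked as Linked using (Linked; []; [-]; _∷_)
import Data.List.Relation.Unary.Linked.Properties as Linked
import Data.List.Relation.Unary.Unique.Propositional.Properties as Unique
import Data.List.Relation.Binary.Permutation.Setoid.Properties as ↭ₛ
open import Data.List.Relation.Binary.Permutation.Propositional using (↭⇒↭ₛ)
open import Data.List.Relation.Binary.Permutation.Propositional.Properties using (↭-length; ++-comm)
open import Function.Bundles using (_⇔_; mk⇔; Equivalence)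
open import Relation.Binary.Definitions using (DecidableEquality; tri<; tri≈; tri>)
open import Relation.Binary.Construct.Closure.ReflexiveTransitive using (Star; ε; _◅_; _◅◅_; gmap)
open import Relation.Binary.PropositionalEquality
  using (_≡_; _≢_; refl; sym; trans; cong; cong₂; subst; subst₂; setoid; module ≡-Reasoning)
open import Relation.Nullary using (¬_; yes; no; does)
open import Relation.Nullary.Decidable using (map′; _×-dec_; dec-true; dec-false)
open import Relation.Unary using (Decidable)

module Graph where

  IsTree : ∀ {V : Set} → (V → V → Set) → Set
  IsTree E = Connected E × Acyclic E

  module _ {V : Set} {E : V → V → Set} where

    Linked-++⁻ˡ : ∀ xs {ys} → Linked E (xs ++ ys) → Linked E xs
    Linked-++⁻ˡ []           _       = []
    Linked-++⁻ˡ (x ∷ [])     _       = [-]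
    Linked-++⁻ˡ (x ∷ y ∷ xs) (e ∷ l) = e ∷ Linked-++⁻ˡ (y ∷ xs) l

    Linked-split : ∀ xs {y ws} → Linked E (xs ++ y ∷ ws) → Linked E (xs ++ [ y ]) × Linked E (y ∷ ws)
    Linked-split []           l       = [-] , l
    Linked-split (x ∷ [])     (e ∷ l) = e ∷ [-] , l
    Linked-split (x ∷ y ∷ xs) (e ∷ l) with Linked-split (y ∷ xs) l
    ... | l₁ , l₂ = e ∷ l₁ , l₂

    Linked-join : ∀ xs {y ws} → Linked E (xs ++ [ y ]) → Linked E (y ∷ ws) → Linked E (xs ++ y ∷ ws)
    Linked-join []           _       l = l
    Linked-join (x ∷ [])     (e ∷ _) l = e ∷ l
    Linked-join (x ∷ y ∷ xs) (e ∷ k) l = e ∷ Linked-join (y ∷ xs) k l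

    IsCycle-linked : ∀ {c} → IsCycle E c → Linked E c
    IsCycle-linked {v ∷ vs} (_ , _ , l) = Linked-++⁻ˡ (v ∷ vs) l

    IsCycle-rotate : ∀ y ys z zs → IsCycle E (y ∷ ys ++ z ∷ zs) → IsCycle E (z ∷ zs ++ y ∷ ys)
    IsCycle-rotate y ys z zs (3≤ , unique , closed) =
      subst (3 ≤_) (↭-length (++-comm (y ∷ ys) (z ∷ zs))) 3≤ ,
      ↭ₛ.Unique-resp-↭ (setoid V) (↭⇒↭ₛ (++-comm (y ∷ ys) (z ∷ zs))) unique ,
      closed′
      where
      closed′ : Linked E ((z ∷ zs ++ y ∷ ys) ++ [ z ])
      closed′ with Linked-split (y ∷ ys) (subst (Linked E) (++-assoc (y ∷ ys) (z ∷ zs) [ y ]) closed)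
      ... | y⋯z , z⋯y = subst (Linked E) (sym (++-assoc (z ∷ zs) (y ∷ ys) [ z ]))
                          (Linked-join (z ∷ zs) (subst (Linked E) (sym (++-assoc [ z ] zs [ y ])) z⋯y) y⋯z)

    IsCycle-startingAt : ∀ {v c} → v ∈ c → IsCycle E c → ∃[ ws ] IsCycle E (v ∷ ws)
    IsCycle-startingAt {v} v∈c cyc with ∈-∃++ v∈c
    ... | []     , zs , refl = zs , cyc
    ... | y ∷ ys , zs , refl = zs ++ y ∷ ys , IsCycle-rotate y ys v zs cyc

  module _ {V W : Set} {E : V → V → Set} {F : W → W → Set} (f : V → W) where

    IsCycle-map⁺ : (∀ {u v} → f u ≡ f v → u ≡ v) → (∀ {u v} → E u v → F (f u) (f v)) →
                   ∀ c → IsCycle E c → IsCycle F (map f c)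
    IsCycle-map⁺ f-inj hom (v ∷ vs) (3≤ , unique , closed) =
      subst (3 ≤_) (sym (length-map f (v ∷ vs))) 3≤ ,
      Unique.map⁺ f-inj unique ,
      subst (Linked F) (map-++ f (v ∷ vs) [ v ]) (Linked.map⁺ (Linked.map hom closed))

    IsCycle-map⁻ : (∀ {u v} → F (f u) (f v) → E u v) → ∀ c → IsCycle F (map f c) → IsCycle E c
    IsCycle-map⁻ reflect (v ∷ vs) (3≤ , unique , closed) =
      subst (3 ≤_) (length-map f (v ∷ vs)) 3≤ ,
      Unique.map⁻ unique ,
      Linked.map reflect (Linked.map⁻ (subst (Linked F) (sym (map-++ f (v ∷ vs) [ v ])) closed))

    All-image : ∀ {ws} → All (λ w → ∃[ u ] w ≡ f u) ws → ∃[ vs ] ws ≡ map f vs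
    All-image []                = [] , refl
    All-image ((u , refl) ∷ ps) with All-image ps
    ... | vs , refl = u ∷ vs , refl

    IsCycle-lift : (∀ {u v} → F (f u) (f v) → E u v) →
                   ∀ {ws} → IsCycle F ws → All (λ w → ∃[ u ] w ≡ f u) ws → ∃[ vs ] IsCycle E vs
    IsCycle-lift reflect cyc inImage with All-image inImage
    ... | vs , refl = vs , IsCycle-map⁻ reflect vs cyc

    Acyclic-embedding : (∀ {u v} → f u ≡ f v → u ≡ v) → (∀ {u v} → E u v → F (f u) (f v)) →
                        Acyclic F → Acyclic E
    Acyclic-embedding f-inj hom acyclic (c , cyc) = acyclic (map f c , IsCycle-map⁺ f-inj hom c cyc)

  module _ {V W : Set} {E : V → V → Set} {F : W → W → Set} (f : V → W) (g : W → V) (f∘g : ∀ w → f (g w) ≡ w) where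

    Connected-retraction : (∀ {u v} → E u v → F (f u) (f v)) → Connected E → Connected F
    Connected-retraction hom connected w w′ =
      subst₂ (Star F) (f∘g w) (f∘g w′) (gmap f hom (connected (g w) (g w′)))

    IsTree-transport : (∀ {u v} → E u v → F (f u) (f v)) → (∀ {w w′} → F w w′ → E (g w) (g w′)) →
                       IsTree E → IsTree F
    IsTree-transport hom hom⁻ (connected , acyclic) =
      Connected-retraction hom connected , Acyclic-embedding g g-inj hom⁻ acyclic
      where
      g-inj : ∀ {w w′} → g w ≡ g w′ → w ≡ w′
      g-inj {w} {w′} eq = trans (sym (f∘g w)) (trans (cong f eq) (f∘g w′))

  module Bridge {V₁ V₂ : Set} (E₁ : V₁ → V₁ → Set) (E₂ : V₂ → V₂ → Set) (a : V₁) (c : V₂) where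

    data Edge : V₁ ⊎ V₂ → V₁ ⊎ V₂ → Set where
      inside₁ : ∀ {u v} → E₁ u v → Edge (inj₁ u) (inj₁ v)
      inside₂ : ∀ {u v} → E₂ u v → Edge (inj₂ u) (inj₂ v)
      across  : Edge (inj₁ a) (inj₂ c)
      back    : Edge (inj₂ c) (inj₁ a)

    Edge-sym : (∀ {u v} → E₁ u v → E₁ v u) → (∀ {u v} → E₂ u v → E₂ v u) → ∀ {u v} → Edge u v → Edge v u
    Edge-sym sym₁ sym₂ (inside₁ e) = inside₁ (sym₁ e)
    Edge-sym sym₁ sym₂ (inside₂ e) = inside₂ (sym₂ e)
    Edge-sym sym₁ sym₂ across      = back
    Edge-sym sym₁ sym₂ back        = across

    connected : Connected E₁ → Connected E₂ → Connected Edge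
    connected c₁ c₂ (inj₁ u) (inj₁ v) = gmap inj₁ inside₁ (c₁ u v)
    connected c₁ c₂ (inj₁ u) (inj₂ v) = gmap inj₁ inside₁ (c₁ u a) ◅◅ across ◅ gmap inj₂ inside₂ (c₂ c v)
    connected c₁ c₂ (inj₂ u) (inj₁ v) = gmap inj₂ inside₂ (c₂ u c) ◅◅ back ◅ gmap inj₁ inside₁ (c₁ a v)
    connected c₁ c₂ (inj₂ u) (inj₂ v) = gmap inj₂ inside₂ (c₂ u v)

    Side₁ Side₂ : V₁ ⊎ V₂ → Set
    Side₁ w = ∃[ u ] w ≡ inj₁ u
    Side₂ w = ∃[ u ] w ≡ inj₂ u

    sides : ∀ {ws} → Linked Edge ws → All Side₁ ws ⊎ All Side₂ ws ⊎ inj₁ a ∈ ws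
    sides [] = inj₁ []
    sides {inj₁ u ∷ []} [-] = inj₁ ((u , refl) ∷ [])
    sides {inj₂ u ∷ []} [-] = inj₂ (inj₁ ((u , refl) ∷ []))
    sides (across ∷ _) = inj₂ (inj₂ (here refl))
    sides (back ∷ _)   = inj₂ (inj₂ (there (here refl)))
    sides (inside₁ _ ∷ l) with sides l
    ... | inj₁ ps                   = inj₁ ((_ , refl) ∷ ps)
    ... | inj₂ (inj₁ ((_ , ()) ∷ _))
    ... | inj₂ (inj₂ m)             = inj₂ (inj₂ (there m))
    sides (inside₂ _ ∷ l) with sides l
    ... | inj₁ ((_ , ()) ∷ _)
    ... | inj₂ (inj₁ ps)            = inj₂ (inj₁ ((_ , refl) ∷ ps))
    ... | inj₂ (inj₂ m)             = inj₂ (inj₂ (there m))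

    inside₁⁻ : ∀ {u v} → Edge (inj₁ u) (inj₁ v) → E₁ u v
    inside₁⁻ (inside₁ e) = e

    inside₂⁻ : ∀ {u v} → Edge (inj₂ u) (inj₂ v) → E₂ u v
    inside₂⁻ (inside₂ e) = e

    returnsVia : ∀ w ws → Linked Edge (w ∷ ws ++ [ inj₁ a ]) → All Side₂ (w ∷ ws) → inj₂ c ∈ w ∷ ws
    returnsVia w []       (back ∷ [-])       _                  = here refl
    returnsVia w []       (inside₁ _ ∷ [-])  ((_ , ()) ∷ _)
    returnsVia w (x ∷ ws) (_ ∷ l)            (_ ∷ ps)           = there (returnsVia x ws l ps)

    -- A cycle through the bridge would have to cross it twice, both times at c.
    acyclic : Acyclic E₁ → Acyclic E₂ → Acyclic Edge
    acyclic ac₁ ac₂ (ws , cyc) with sides (IsCycle-linked cyc)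
    ... | inj₁ ps        = ac₁ (IsCycle-lift inj₁ inside₁⁻ cyc ps)
    ... | inj₂ (inj₁ ps) = ac₂ (IsCycle-lift inj₂ inside₂⁻ cyc ps)
    ... | inj₂ (inj₂ m)  = throughBridge (IsCycle-startingAt m cyc)
      where
      throughBridge : ∃[ vs ] IsCycle Edge (inj₁ a ∷ vs) → ⊥
      throughBridge (vs , cyc′@(_ , unique , closed)) with sides (Linked-++⁻ˡ vs (Linked.tail closed))
      ... | inj₁ ps        = ac₁ (IsCycle-lift inj₁ inside₁⁻ cyc′ ((a , refl) ∷ ps))
      ... | inj₂ (inj₂ m)  = Unique.Unique[x∷xs]⇒x∉xs unique m
      ... | inj₂ (inj₁ ps) = crossesTwice cyc′ ps
        where
        crossesTwice : ∀ {vs} → IsCycle Edge (inj₁ a ∷ vs) → All Side₂ vs → ⊥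
        crossesTwice {[]}     (s≤s () , _)
        crossesTwice {_ ∷ []} (s≤s (s≤s ()) , _)
        crossesTwice {_ ∷ x ∷ xs} (_ , _ ∷ unique , across ∷ _ ∷ closed) (_ ∷ ps) =
          Unique.Unique[x∷xs]⇒x∉xs unique (returnsVia x xs closed ps)
        crossesTwice {_ ∷ _ ∷ _} (_ , _ , inside₁ _ ∷ _) ((_ , ()) ∷ _)

    tree : IsTree E₁ → IsTree E₂ → IsTree Edge
    tree (c₁ , ac₁) (c₂ , ac₂) = connected c₁ c₂ , acyclic ac₁ ac₂

  Point : ⊤ → ⊤ → Set
  Point _ _ = ⊥

  Point-tree : IsTree Point
  Point-tree = (λ { tt tt → ε }) , λ { (_ ∷ [] , _ , _ , () ∷ _) ; (_ ∷ _ ∷ _ , _ , _ , () ∷ _) }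

module ProofStructure where

  open Graph
  open Bridge using (inside₁; inside₂; across; back)

  infixr 4 _⊕_

  data Sequent : Set where
    ⟨_⟩ : Formula → Sequent
    ∅   : Sequent
    _⊕_ : Sequent → Sequent → Sequent

  Nodeˢ : Sequent → Set
  Nodeˢ ⟨ A ⟩   = Node A
  Nodeˢ ∅       = ⊥
  Nodeˢ (S ⊕ T) = Nodeˢ S ⊎ Nodeˢ T

  Leafˢ : Sequent → Set
  Leafˢ ⟨ A ⟩   = Leaf A
  Leafˢ ∅       = ⊥
  Leafˢ (S ⊕ T) = Leafˢ S ⊎ Leafˢ T

  Switchingˢ : Sequent → Set
  Switchingˢ ⟨ A ⟩   = Switching A
  Switchingˢ ∅       = ⊤
  Switchingˢ (S ⊕ T) = Switchingˢ S × Switchingˢ T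

  TEdgeˢ : (S : Sequent) → Switchingˢ S → Nodeˢ S → Nodeˢ S → Set
  TEdgeˢ ⟨ A ⟩   s       u        v        = TEdge A s u v
  TEdgeˢ (S ⊕ T) (s , _) (inj₁ u) (inj₁ v) = TEdgeˢ S s u v
  TEdgeˢ (S ⊕ T) (_ , t) (inj₂ u) (inj₂ v) = TEdgeˢ T t u v
  TEdgeˢ (S ⊕ T) _       (inj₁ _) (inj₂ _) = ⊥
  TEdgeˢ (S ⊕ T) _       (inj₂ _) (inj₁ _) = ⊥

  leafNodeˢ : ∀ {S} → Leafˢ S → Nodeˢ S
  leafNodeˢ {⟨ A ⟩} x        = leafNode x
  leafNodeˢ {S ⊕ T} (inj₁ x) = inj₁ (leafNodeˢ x)
  leafNodeˢ {S ⊕ T} (inj₂ x) = inj₂ (leafNodeˢ x)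

  labelˢ : ∀ {S} → Leafˢ S → Lit
  labelˢ {⟨ A ⟩} x        = label x
  labelˢ {S ⊕ T} (inj₁ x) = labelˢ x
  labelˢ {S ⊕ T} (inj₂ x) = labelˢ x

  record AxiomLinkingˢ (S : Sequent) : Set where
    field
      link       : Leafˢ S → Leafˢ S
      involutive : ∀ x → link (link x) ≡ x
      dualLabel  : ∀ x → labelˢ (link x) ≡ dual (labelˢ x)

  open AxiomLinkingˢ

  AxiomEdge : ∀ {S} → AxiomLinkingˢ S → Nodeˢ S → Nodeˢ S → Set
  AxiomEdge {S} ax u v = Σ[ x ∈ Leafˢ S ] (u ≡ leafNodeˢ x × v ≡ leafNodeˢ (link ax x))

  Adjˢ : ∀ S → AxiomLinkingˢ S → Switchingˢ S → Nodeˢ S → Nodeˢ S → Set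
  Adjˢ S ax s u v = TEdgeˢ S s u v ⊎ TEdgeˢ S s v u ⊎ AxiomEdge ax u v

  Adjˢ-sym : ∀ {S ax s u v} → Adjˢ S ax s u v → Adjˢ S ax s v u
  Adjˢ-sym (inj₁ e)                        = inj₂ (inj₁ e)
  Adjˢ-sym (inj₂ (inj₁ e))                 = inj₁ e
  Adjˢ-sym {ax = ax} (inj₂ (inj₂ (x , refl , refl))) =
    inj₂ (inj₂ (link ax x , refl , cong leafNodeˢ (sym (involutive ax x))))

  record Net (S : Sequent) : Set where
    constructor net
    field
      axioms  : AxiomLinkingˢ S
      correct : ∀ s → IsTree (Adjˢ S axioms s)

  Net⇒ProofNet : ∀ {A} → Net ⟨ A ⟩ → ProofNet A
  Net⇒ProofNet (net ax correct) = record
    { axioms  = record { link = link ax ; involutive = involutive ax ; dualLabel = dualLabel ax }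
    ; correct = correct
    }

  record LeafIso (S T : Sequent) : Set where
    field
      to       : Leafˢ S → Leafˢ T
      from     : Leafˢ T → Leafˢ S
      from∘to  : ∀ x → from (to x) ≡ x
      to∘from  : ∀ y → to (from y) ≡ y
      label-to : ∀ x → labelˢ (to x) ≡ labelˢ x

  module _ {S T : Sequent} (L : LeafIso S T) where
    open LeafIso L

    transportLinking : AxiomLinkingˢ S → AxiomLinkingˢ T
    transportLinking ax = record
      { link       = λ y → to (link ax (from y))
      ; involutive = λ y → trans (cong (λ x → to (link ax x)) (from∘to _))
                             (trans (cong to (involutive ax _)) (to∘from y))
      ; dualLabel  = λ y → trans (label-to _) (trans (dualLabel ax _)
                             (cong dual (trans (sym (label-to _)) (cong labelˢ (to∘from y)))))
      }

    module _ (ax : AxiomLinkingˢ S) {V : Set} (ι : Nodeˢ S → V) where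

      axiomEdge-reflect : ∀ {G : V → V → Set} (g : Nodeˢ T → V) → (∀ y → g (leafNodeˢ y) ≡ ι (leafNodeˢ (from y))) →
                          (∀ x → G (ι (leafNodeˢ x)) (ι (leafNodeˢ (link ax x)))) →
                          ∀ {u v} → AxiomEdge (transportLinking ax) u v → G (g u) (g v)
      axiomEdge-reflect {G} g g-leaf linked (y , refl , refl) =
        subst₂ G (sym (g-leaf y)) (sym (trans (g-leaf _) (cong (λ x → ι (leafNodeˢ x)) (from∘to _))))
          (linked (from y))

      axiomEdge-preserve : (f : V → Nodeˢ T) → (∀ x → f (ι (leafNodeˢ x)) ≡ leafNodeˢ (to x)) →
                           ∀ x → AxiomEdge (transportLinking ax) (f (ι (leafNodeˢ x))) (f (ι (leafNodeˢ (link ax x))))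
      axiomEdge-preserve f f-leaf x =
        to x , f-leaf x , trans (f-leaf _) (cong (λ x′ → leafNodeˢ (to (link ax x′))) (sym (from∘to x)))

  record _≅_ (S T : Sequent) : Set where
    field
      leaves     : LeafIso S T
      node       : Nodeˢ S → Nodeˢ T
      node⁻      : Nodeˢ T → Nodeˢ S
      node∘node⁻ : ∀ w → node (node⁻ w) ≡ w
      node-leaf  : ∀ x → node (leafNodeˢ x) ≡ leafNodeˢ (LeafIso.to leaves x)
      node⁻-leaf : ∀ y → node⁻ (leafNodeˢ y) ≡ leafNodeˢ (LeafIso.from leaves y)
      switching  : Switchingˢ T → Switchingˢ S
      edge       : ∀ {t u v} → TEdgeˢ S (switching t) u v → TEdgeˢ T t (node u) (node v)
      edge⁻      : ∀ {t w w′} → TEdgeˢ T t w w′ → TEdgeˢ S (switching t) (node⁻ w) (node⁻ w′)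

    open LeafIso leaves public

  Net-transport : ∀ {S T} → S ≅ T → Net S → Net T
  Net-transport {S} {T} I (net ax correct) = net (transportLinking leaves ax) correct′
    where
    open _≅_ I
    correct′ : ∀ t → IsTree (Adjˢ T (transportLinking leaves ax) t)
    correct′ t = IsTree-transport node node⁻ node∘node⁻ hom hom⁻ (correct (switching t))
      where
      hom : ∀ {u v} → Adjˢ S ax (switching t) u v → Adjˢ T (transportLinking leaves ax) t (node u) (node v)
      hom (inj₁ e)                        = inj₁ (edge e)
      hom (inj₂ (inj₁ e))                 = inj₂ (inj₁ (edge e))
      hom (inj₂ (inj₂ (x , refl , refl))) = inj₂ (inj₂ (axiomEdge-preserve leaves ax (λ u → u) node node-leaf x))
      hom⁻ : ∀ {w w′} → Adjˢ T (transportLinking leaves ax) t w w′ → Adjˢ S ax (switching t) (node⁻ w) (node⁻ w′)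
      hom⁻ (inj₁ e)        = inj₁ (edge⁻ e)
      hom⁻ (inj₂ (inj₁ e)) = inj₂ (inj₁ (edge⁻ e))
      hom⁻ (inj₂ (inj₂ a)) =
        axiomEdge-reflect leaves ax (λ u → u) {Adjˢ S ax (switching t)} node⁻ node⁻-leaf
          (λ x → inj₂ (inj₂ (x , refl , refl))) a

  ≅-refl : ∀ {S} → S ≅ S
  ≅-refl = record
    { leaves     = record
      { to = λ x → x ; from = λ x → x ; from∘to = λ _ → refl ; to∘from = λ _ → refl ; label-to = λ _ → refl }
    ; node       = λ u → u
    ; node⁻      = λ u → u
    ; node∘node⁻ = λ _ → refl
    ; node-leaf  = λ _ → refl
    ; node⁻-leaf = λ _ → refl
    ; switching  = λ t → t
    ; edge       = λ e → e
    ; edge⁻      = λ e → e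
    }

  ≅-trans : ∀ {S T U} → S ≅ T → T ≅ U → S ≅ U
  ≅-trans I J = record
    { leaves     = record
      { to       = λ x → J.to (I.to x)
      ; from     = λ z → I.from (J.from z)
      ; from∘to  = λ x → trans (cong I.from (J.from∘to (I.to x))) (I.from∘to x)
      ; to∘from  = λ z → trans (cong J.to (I.to∘from (J.from z))) (J.to∘from z)
      ; label-to = λ x → trans (J.label-to (I.to x)) (I.label-to x)
      }
    ; node       = λ u → J.node (I.node u)
    ; node⁻      = λ w → I.node⁻ (J.node⁻ w)
    ; node∘node⁻ = λ w → trans (cong J.node (I.node∘node⁻ (J.node⁻ w))) (J.node∘node⁻ w)
    ; node-leaf  = λ x → trans (cong J.node (I.node-leaf x)) (J.node-leaf (I.to x))
    ; node⁻-leaf = λ z → trans (cong I.node⁻ (J.node⁻-leaf z)) (I.node⁻-leaf (J.from z))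
    ; switching  = λ t → I.switching (J.switching t)
    ; edge       = λ e → J.edge (I.edge e)
    ; edge⁻      = λ e → I.edge⁻ (J.edge⁻ e)
    }
    where
    module I = _≅_ I
    module J = _≅_ J

  ⊕-comm : ∀ {S T} → (S ⊕ T) ≅ (T ⊕ S)
  ⊕-comm {S} {T} = record
    { leaves     = record
      { to = ⊎.swap ; from = ⊎.swap ; from∘to = swap-involutive ; to∘from = swap-involutive ; label-to = label-swap }
    ; node       = ⊎.swap
    ; node⁻      = ⊎.swap
    ; node∘node⁻ = swap-involutive
    ; node-leaf  = leaf-swap
    ; node⁻-leaf = leaf-swap
    ; switching  = ×.swap
    ; edge       = λ {_} {u} {v} → swap-edge {S} {T} {u = u} {v}
    ; edge⁻      = λ {_} {u} {v} → swap-edge {T} {S} {u = u} {v}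
    }
    where
    label-swap : ∀ {S T} (x : Leafˢ (S ⊕ T)) → labelˢ {T ⊕ S} (⊎.swap x) ≡ labelˢ x
    label-swap (inj₁ _) = refl
    label-swap (inj₂ _) = refl
    leaf-swap : ∀ {S T} (x : Leafˢ (S ⊕ T)) → ⊎.swap (leafNodeˢ x) ≡ leafNodeˢ {T ⊕ S} (⊎.swap x)
    leaf-swap (inj₁ _) = refl
    leaf-swap (inj₂ _) = refl
    swap-edge : ∀ {S T s t u v} → TEdgeˢ (S ⊕ T) (s , t) u v → TEdgeˢ (T ⊕ S) (t , s) (⊎.swap u) (⊎.swap v)
    swap-edge {u = inj₁ _} {inj₁ _} e = e
    swap-edge {u = inj₂ _} {inj₂ _} e = e

  ⊕-assoc : ∀ {S T U} → ((S ⊕ T) ⊕ U) ≅ (S ⊕ (T ⊕ U))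
  ⊕-assoc {S} {T} {U} = record
    { leaves     = record
      { to = ⊎.assocʳ ; from = ⊎.assocˡ ; from∘to = assocˡ∘assocʳ ; to∘from = assocʳ∘assocˡ ; label-to = label-assoc }
    ; node       = ⊎.assocʳ
    ; node⁻      = ⊎.assocˡ
    ; node∘node⁻ = assocʳ∘assocˡ
    ; node-leaf  = leaf-assocʳ
    ; node⁻-leaf = leaf-assocˡ
    ; switching  = ×.assocˡ′
    ; edge       = λ {t} {u} {v} → edge {t} {u} {v}
    ; edge⁻      = λ {t} {u} {v} → edge⁻ {t} {u} {v}
    }
    where
    assocˡ∘assocʳ : ∀ {A B C : Set} (x : (A ⊎ B) ⊎ C) → ⊎.assocˡ (⊎.assocʳ x) ≡ x
    assocˡ∘assocʳ (inj₁ (inj₁ _)) = refl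
    assocˡ∘assocʳ (inj₁ (inj₂ _)) = refl
    assocˡ∘assocʳ (inj₂ _)        = refl
    assocʳ∘assocˡ : ∀ {A B C : Set} (x : A ⊎ (B ⊎ C)) → ⊎.assocʳ (⊎.assocˡ x) ≡ x
    assocʳ∘assocˡ (inj₁ _)        = refl
    assocʳ∘assocˡ (inj₂ (inj₁ _)) = refl
    assocʳ∘assocˡ (inj₂ (inj₂ _)) = refl
    label-assoc : (x : Leafˢ ((S ⊕ T) ⊕ U)) → labelˢ {S ⊕ (T ⊕ U)} (⊎.assocʳ x) ≡ labelˢ x
    label-assoc (inj₁ (inj₁ _)) = refl
    label-assoc (inj₁ (inj₂ _)) = refl
    label-assoc (inj₂ _)        = refl
    leaf-assocʳ : (x : Leafˢ ((S ⊕ T) ⊕ U)) → ⊎.assocʳ (leafNodeˢ x) ≡ leafNodeˢ {S ⊕ (T ⊕ U)} (⊎.assocʳ x)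
    leaf-assocʳ (inj₁ (inj₁ _)) = refl
    leaf-assocʳ (inj₁ (inj₂ _)) = refl
    leaf-assocʳ (inj₂ _)        = refl
    leaf-assocˡ : (x : Leafˢ (S ⊕ (T ⊕ U))) → ⊎.assocˡ (leafNodeˢ x) ≡ leafNodeˢ {(S ⊕ T) ⊕ U} (⊎.assocˡ x)
    leaf-assocˡ (inj₁ _)        = refl
    leaf-assocˡ (inj₂ (inj₁ _)) = refl
    leaf-assocˡ (inj₂ (inj₂ _)) = refl
    edge : ∀ {t u v} → TEdgeˢ ((S ⊕ T) ⊕ U) (×.assocˡ′ t) u v → TEdgeˢ (S ⊕ (T ⊕ U)) t (⊎.assocʳ u) (⊎.assocʳ v)
    edge {_ , _ , _} {inj₁ (inj₁ _)} {inj₁ (inj₁ _)} e = e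
    edge {_ , _ , _} {inj₁ (inj₂ _)} {inj₁ (inj₂ _)} e = e
    edge {_ , _ , _} {inj₂ _}        {inj₂ _}        e = e
    edge⁻ : ∀ {t u v} → TEdgeˢ (S ⊕ (T ⊕ U)) t u v → TEdgeˢ ((S ⊕ T) ⊕ U) (×.assocˡ′ t) (⊎.assocˡ u) (⊎.assocˡ v)
    edge⁻ {_ , _ , _} {inj₁ _}        {inj₁ _}        e = e
    edge⁻ {_ , _ , _} {inj₂ (inj₁ _)} {inj₂ (inj₁ _)} e = e
    edge⁻ {_ , _ , _} {inj₂ (inj₂ _)} {inj₂ (inj₂ _)} e = e

  ⊕-congˡ : ∀ {S S′ T} → S ≅ S′ → (S ⊕ T) ≅ (S′ ⊕ T)
  ⊕-congˡ {S} {S′} {T} I = record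
    { leaves     = record
      { to       = ⊎.map₁ I.to
      ; from     = ⊎.map₁ I.from
      ; from∘to  = ⊎.[ (λ x → cong inj₁ (I.from∘to x)) , (λ _ → refl) ]
      ; to∘from  = ⊎.[ (λ x → cong inj₁ (I.to∘from x)) , (λ _ → refl) ]
      ; label-to = ⊎.[ I.label-to , (λ _ → refl) ]
      }
    ; node       = ⊎.map₁ I.node
    ; node⁻      = ⊎.map₁ I.node⁻
    ; node∘node⁻ = ⊎.[ (λ u → cong inj₁ (I.node∘node⁻ u)) , (λ _ → refl) ]
    ; node-leaf  = ⊎.[ (λ x → cong inj₁ (I.node-leaf x)) , (λ _ → refl) ]
    ; node⁻-leaf = ⊎.[ (λ x → cong inj₁ (I.node⁻-leaf x)) , (λ _ → refl) ]
    ; switching  = ×.map₁ I.switching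
    ; edge       = λ {t} {u} {v} → edge {t} {u} {v}
    ; edge⁻      = λ {t} {u} {v} → edge⁻ {t} {u} {v}
    }
    where
    module I = _≅_ I
    edge : ∀ {t u v} → TEdgeˢ (S ⊕ T) (×.map₁ I.switching t) u v →
           TEdgeˢ (S′ ⊕ T) t (⊎.map₁ I.node u) (⊎.map₁ I.node v)
    edge {_ , _} {inj₁ _} {inj₁ _} e = I.edge e
    edge {_ , _} {inj₂ _} {inj₂ _} e = e
    edge⁻ : ∀ {t u v} → TEdgeˢ (S′ ⊕ T) t u v →
            TEdgeˢ (S ⊕ T) (×.map₁ I.switching t) (⊎.map₁ I.node⁻ u) (⊎.map₁ I.node⁻ v)
    edge⁻ {_ , _} {inj₁ _} {inj₁ _} e = I.edge⁻ e
    edge⁻ {_ , _} {inj₂ _} {inj₂ _} e = e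

  private
    fromInj₂ : ∀ {A : Set} → ⊥ ⊎ A → A
    fromInj₂ (inj₂ x) = x

    inj₂∘fromInj₂ : ∀ {A : Set} (x : ⊥ ⊎ A) → inj₂ (fromInj₂ x) ≡ x
    inj₂∘fromInj₂ (inj₂ _) = refl

    leaf-fromInj₂ : ∀ {S} (x : Leafˢ (∅ ⊕ S)) → fromInj₂ (leafNodeˢ x) ≡ leafNodeˢ {S} (fromInj₂ x)
    leaf-fromInj₂ (inj₂ _) = refl

    label-fromInj₂ : ∀ {S} (x : Leafˢ (∅ ⊕ S)) → labelˢ {S} (fromInj₂ x) ≡ labelˢ x
    label-fromInj₂ (inj₂ _) = refl

    edge-fromInj₂ : ∀ {S t u v} → TEdgeˢ (∅ ⊕ S) t u v → TEdgeˢ S (proj₂ t) (fromInj₂ u) (fromInj₂ v)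
    edge-fromInj₂ {u = inj₂ _} {inj₂ _} e = e

  ∅-identityˡ : ∀ {S} → (∅ ⊕ S) ≅ S
  ∅-identityˡ {S} = record
    { leaves     = record
      { to = fromInj₂ ; from = inj₂ ; from∘to = inj₂∘fromInj₂ ; to∘from = λ _ → refl ; label-to = label-fromInj₂ }
    ; node       = fromInj₂
    ; node⁻      = inj₂
    ; node∘node⁻ = λ _ → refl
    ; node-leaf  = leaf-fromInj₂
    ; node⁻-leaf = λ _ → refl
    ; switching  = tt ,_
    ; edge       = λ {_} {u} {v} → edge-fromInj₂ {S} {u = u} {v}
    ; edge⁻      = λ e → e
    }

  ∅-identityˡ⁻ : ∀ {S} → S ≅ (∅ ⊕ S)
  ∅-identityˡ⁻ {S} = record
    { leaves     = record
      { to = inj₂ ; from = fromInj₂ ; from∘to = λ _ → refl ; to∘from = inj₂∘fromInj₂ ; label-to = λ _ → refl }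
    ; node       = inj₂
    ; node⁻      = fromInj₂
    ; node∘node⁻ = inj₂∘fromInj₂
    ; node-leaf  = λ _ → refl
    ; node⁻-leaf = leaf-fromInj₂
    ; switching  = proj₂
    ; edge       = λ e → e
    ; edge⁻      = λ {_} {u} {v} → edge-fromInj₂ {S} {u = u} {v}
    }

  dual-involutive : ∀ l → dual (dual l) ≡ l
  dual-involutive (mkLit x b) = cong (mkLit x) (not-involutive b)

  axiom-net : ∀ l → Net (⟨ lit l ⟩ ⊕ ⟨ lit (dual l) ⟩)
  axiom-net l = net axioms correct
    where
    S : Sequent
    S = ⟨ lit l ⟩ ⊕ ⟨ lit (dual l) ⟩
    swapped : Leafˢ S → Leafˢ S
    swapped (inj₁ here) = inj₂ here
    swapped (inj₂ here) = inj₁ here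
    axioms : AxiomLinkingˢ S
    axioms = record { link = swapped ; involutive = involutive′ ; dualLabel = dualLabel′ }
      where
      involutive′ : ∀ x → swapped (swapped x) ≡ x
      involutive′ (inj₁ here) = refl
      involutive′ (inj₂ here) = refl
      dualLabel′ : ∀ x → labelˢ (swapped x) ≡ dual (labelˢ x)
      dualLabel′ (inj₁ here) = refl
      dualLabel′ (inj₂ here) = sym (dual-involutive l)
    module B = Bridge Point Point tt tt
    embed : ⊤ ⊎ ⊤ → Nodeˢ S
    embed (inj₁ tt) = inj₁ root
    embed (inj₂ tt) = inj₂ root
    project : Nodeˢ S → ⊤ ⊎ ⊤
    project (inj₁ root) = inj₁ tt
    project (inj₂ root) = inj₂ tt
    embed∘project : ∀ u → embed (project u) ≡ u
    embed∘project (inj₁ root) = refl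
    embed∘project (inj₂ root) = refl
    hom : ∀ {w w′} → B.Edge w w′ → Adjˢ S axioms (tt , tt) (embed w) (embed w′)
    hom across = inj₂ (inj₂ (inj₁ here , refl , refl))
    hom back   = inj₂ (inj₂ (inj₂ here , refl , refl))
    hom⁻ : ∀ {u v} → Adjˢ S axioms (tt , tt) u v → B.Edge (project u) (project v)
    hom⁻ {inj₁ root} {inj₁ root} (inj₁ ())
    hom⁻ {inj₂ root} {inj₂ root} (inj₁ ())
    hom⁻ {inj₁ root} {inj₁ root} (inj₂ (inj₁ ()))
    hom⁻ {inj₂ root} {inj₂ root} (inj₂ (inj₁ ()))
    hom⁻ (inj₂ (inj₂ (inj₁ here , refl , refl))) = across
    hom⁻ (inj₂ (inj₂ (inj₂ here , refl , refl))) = back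
    correct : ∀ s → IsTree (Adjˢ S axioms s)
    correct (tt , tt) = IsTree-transport embed project embed∘project hom hom⁻ (B.tree Point-tree Point-tree)

  module _ {X Y : Formula} {R : Sequent} where
    private
      S = (⟨ X ⟩ ⊕ ⟨ Y ⟩) ⊕ R
      T = ⟨ X ∨ᶠ Y ⟩ ⊕ R

    ∨-leaves : LeafIso S T
    ∨-leaves = record { to = to ; from = from ; from∘to = from∘to ; to∘from = to∘from ; label-to = label-to }
      where
      to : Leafˢ S → Leafˢ T
      to (inj₁ (inj₁ x)) = inj₁ (∨l x)
      to (inj₁ (inj₂ x)) = inj₁ (∨r x)
      to (inj₂ x)        = inj₂ x
      from : Leafˢ T → Leafˢ S
      from (inj₁ (∨l x)) = inj₁ (inj₁ x)
      from (inj₁ (∨r x)) = inj₁ (inj₂ x)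
      from (inj₂ x)      = inj₂ x
      from∘to : ∀ x → from (to x) ≡ x
      from∘to (inj₁ (inj₁ _)) = refl
      from∘to (inj₁ (inj₂ _)) = refl
      from∘to (inj₂ _)        = refl
      to∘from : ∀ y → to (from y) ≡ y
      to∘from (inj₁ (∨l _)) = refl
      to∘from (inj₁ (∨r _)) = refl
      to∘from (inj₂ _)      = refl
      label-to : ∀ x → labelˢ (to x) ≡ labelˢ x
      label-to (inj₁ (inj₁ _)) = refl
      label-to (inj₁ (inj₂ _)) = refl
      label-to (inj₂ _)        = refl

    -- Under a switching, the new ∨-vertex is a leaf of the switching graph hanging off the chosen argument.
    ∨-net : Net S → Net T
    ∨-net (net ax correct) = net (transportLinking ∨-leaves ax) correct′
      where
      correct′ : ∀ t → IsTree (Adjˢ T (transportLinking ∨-leaves ax) t)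
      correct′ ((b , sX , sY) , sR) =
        IsTree-transport embed project embed∘project hom hom⁻ (B.tree Point-tree (correct ((sX , sY) , sR)))
        where
        chosen : Bool → Nodeˢ S
        chosen true  = inj₁ (inj₁ root)
        chosen false = inj₁ (inj₂ root)
        module B = Bridge Point (Adjˢ S ax ((sX , sY) , sR)) tt (chosen b)
        embed : ⊤ ⊎ Nodeˢ S → Nodeˢ T
        embed (inj₁ tt)              = inj₁ root
        embed (inj₂ (inj₁ (inj₁ u))) = inj₁ (∨l u)
        embed (inj₂ (inj₁ (inj₂ u))) = inj₁ (∨r u)
        embed (inj₂ (inj₂ u))        = inj₂ u
        project : Nodeˢ T → ⊤ ⊎ Nodeˢ S
        project (inj₁ root)   = inj₁ tt
        project (inj₁ (∨l u)) = inj₂ (inj₁ (inj₁ u))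
        project (inj₁ (∨r u)) = inj₂ (inj₁ (inj₂ u))
        project (inj₂ u)      = inj₂ (inj₂ u)
        embed∘project : ∀ w → embed (project w) ≡ w
        embed∘project (inj₁ root)   = refl
        embed∘project (inj₁ (∨l _)) = refl
        embed∘project (inj₁ (∨r _)) = refl
        embed∘project (inj₂ _)      = refl
        embed-leaf : ∀ x → embed (inj₂ (leafNodeˢ x)) ≡ leafNodeˢ (LeafIso.to ∨-leaves x)
        embed-leaf (inj₁ (inj₁ _)) = refl
        embed-leaf (inj₁ (inj₂ _)) = refl
        embed-leaf (inj₂ _)        = refl
        project-leaf : ∀ y → project (leafNodeˢ y) ≡ inj₂ (leafNodeˢ (LeafIso.from ∨-leaves y))
        project-leaf (inj₁ (∨l _)) = refl
        project-leaf (inj₁ (∨r _)) = refl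
        project-leaf (inj₂ _)      = refl
        edge : ∀ {u v} → TEdgeˢ S ((sX , sY) , sR) u v → TEdgeˢ T ((b , sX , sY) , sR) (embed (inj₂ u)) (embed (inj₂ v))
        edge {inj₁ (inj₁ _)} {inj₁ (inj₁ _)} e = ∨l e
        edge {inj₁ (inj₂ _)} {inj₁ (inj₂ _)} e = ∨r e
        edge {inj₂ _}        {inj₂ _}        e = e
        root-edge : ∀ b′ → TEdgeˢ T ((b′ , sX , sY) , sR) (inj₁ root) (embed (inj₂ (chosen b′)))
        root-edge true  = ∨-left
        root-edge false = ∨-right
        hom : ∀ {w w′} → B.Edge w w′ →
              Adjˢ T (transportLinking ∨-leaves ax) ((b , sX , sY) , sR) (embed w) (embed w′)
        hom (inside₂ {u} {v} (inj₁ e))        = inj₁ (edge {u} {v} e)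
        hom (inside₂ {u} {v} (inj₂ (inj₁ e))) = inj₂ (inj₁ (edge {v} {u} e))
        hom (inside₂ (inj₂ (inj₂ (x , refl , refl)))) =
          inj₂ (inj₂ (axiomEdge-preserve ∨-leaves ax inj₂ embed embed-leaf x))
        hom across = inj₁ (root-edge b)
        hom back   = inj₂ (inj₁ (root-edge b))
        edge⁻ : ∀ {u v} → TEdgeˢ T ((b , sX , sY) , sR) u v → B.Edge (project u) (project v)
        edge⁻ {inj₁ _} {inj₁ _} ∨-left  = across
        edge⁻ {inj₁ _} {inj₁ _} ∨-right = across
        edge⁻ {inj₁ _} {inj₁ _} (∨l e)  = inside₂ (inj₁ e)
        edge⁻ {inj₁ _} {inj₁ _} (∨r e)  = inside₂ (inj₁ e)
        edge⁻ {inj₂ _} {inj₂ _} e       = inside₂ (inj₁ e)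
        hom⁻ : ∀ {w w′} → Adjˢ T (transportLinking ∨-leaves ax) ((b , sX , sY) , sR) w w′ →
               B.Edge (project w) (project w′)
        hom⁻ (inj₁ e)        = edge⁻ e
        hom⁻ (inj₂ (inj₁ e)) = B.Edge-sym (λ ()) (Adjˢ-sym {ax = ax}) (edge⁻ e)
        hom⁻ (inj₂ (inj₂ a)) =
          axiomEdge-reflect ∨-leaves ax inj₂ {B.Edge} project project-leaf
            (λ x → inside₂ (inj₂ (inj₂ (x , refl , refl)))) a

  _⊕ᴬ_ : ∀ {S T} → AxiomLinkingˢ S → AxiomLinkingˢ T → AxiomLinkingˢ (S ⊕ T)
  ax₁ ⊕ᴬ ax₂ = record
    { link       = ⊎.map (link ax₁) (link ax₂)
    ; involutive = ⊎.[ (λ x → cong inj₁ (involutive ax₁ x)) , (λ x → cong inj₂ (involutive ax₂ x)) ]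
    ; dualLabel  = ⊎.[ dualLabel ax₁ , dualLabel ax₂ ]
    }

  module _ {X Y : Formula} {R₁ R₂ : Sequent} where
    private
      S₁ = ⟨ X ⟩ ⊕ R₁
      S₂ = ⟨ Y ⟩ ⊕ R₂
      T  = ⟨ X ∧ᶠ Y ⟩ ⊕ (R₁ ⊕ R₂)

    ∧-leaves : LeafIso (S₁ ⊕ S₂) T
    ∧-leaves = record { to = to ; from = from ; from∘to = from∘to ; to∘from = to∘from ; label-to = label-to }
      where
      to : Leafˢ (S₁ ⊕ S₂) → Leafˢ T
      to (inj₁ (inj₁ x)) = inj₁ (∧l x)
      to (inj₂ (inj₁ y)) = inj₁ (∧r y)
      to (inj₁ (inj₂ r)) = inj₂ (inj₁ r)
      to (inj₂ (inj₂ r)) = inj₂ (inj₂ r)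
      from : Leafˢ T → Leafˢ (S₁ ⊕ S₂)
      from (inj₁ (∧l x))   = inj₁ (inj₁ x)
      from (inj₁ (∧r y))   = inj₂ (inj₁ y)
      from (inj₂ (inj₁ r)) = inj₁ (inj₂ r)
      from (inj₂ (inj₂ r)) = inj₂ (inj₂ r)
      from∘to : ∀ x → from (to x) ≡ x
      from∘to (inj₁ (inj₁ _)) = refl
      from∘to (inj₂ (inj₁ _)) = refl
      from∘to (inj₁ (inj₂ _)) = refl
      from∘to (inj₂ (inj₂ _)) = refl
      to∘from : ∀ y → to (from y) ≡ y
      to∘from (inj₁ (∧l _))   = refl
      to∘from (inj₁ (∧r _))   = refl
      to∘from (inj₂ (inj₁ _)) = refl
      to∘from (inj₂ (inj₂ _)) = refl
      label-to : ∀ x → labelˢ (to x) ≡ labelˢ x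
      label-to (inj₁ (inj₁ _)) = refl
      label-to (inj₂ (inj₁ _)) = refl
      label-to (inj₁ (inj₂ _)) = refl
      label-to (inj₂ (inj₂ _)) = refl

    -- Under a switching, the new ∧-vertex joins the two separate switching graphs by two bridges.
    ∧-net : Net S₁ → Net S₂ → Net T
    ∧-net (net ax₁ correct₁) (net ax₂ correct₂) = net (transportLinking ∧-leaves ax) correct′
      where
      ax = ax₁ ⊕ᴬ ax₂
      correct′ : ∀ t → IsTree (Adjˢ T (transportLinking ∧-leaves ax) t)
      correct′ t@((sX , sY) , (s₁ , s₂)) =
        IsTree-transport embed project embed∘project hom hom⁻
          (B₂.tree (B₁.tree Point-tree (correct₁ (sX , s₁))) (correct₂ (sY , s₂)))
        where
        G₁ : Nodeˢ S₁ → Nodeˢ S₁ → Set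
        G₁ = Adjˢ S₁ ax₁ (sX , s₁)
        G₂ : Nodeˢ S₂ → Nodeˢ S₂ → Set
        G₂ = Adjˢ S₂ ax₂ (sY , s₂)
        module B₁ = Bridge Point G₁ tt (inj₁ root)
        module B₂ = Bridge B₁.Edge G₂ (inj₁ tt) (inj₁ root)
        V : Set
        V = (⊤ ⊎ Nodeˢ S₁) ⊎ Nodeˢ S₂
        embed : V → Nodeˢ T
        embed (inj₁ (inj₁ tt))        = inj₁ root
        embed (inj₁ (inj₂ (inj₁ u))) = inj₁ (∧l u)
        embed (inj₂ (inj₁ u))        = inj₁ (∧r u)
        embed (inj₁ (inj₂ (inj₂ r))) = inj₂ (inj₁ r)
        embed (inj₂ (inj₂ r))        = inj₂ (inj₂ r)
        project : Nodeˢ T → V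
        project (inj₁ root)     = inj₁ (inj₁ tt)
        project (inj₁ (∧l u))   = inj₁ (inj₂ (inj₁ u))
        project (inj₁ (∧r u))   = inj₂ (inj₁ u)
        project (inj₂ (inj₁ r)) = inj₁ (inj₂ (inj₂ r))
        project (inj₂ (inj₂ r)) = inj₂ (inj₂ r)
        embed∘project : ∀ w → embed (project w) ≡ w
        embed∘project (inj₁ root)     = refl
        embed∘project (inj₁ (∧l _))   = refl
        embed∘project (inj₁ (∧r _))   = refl
        embed∘project (inj₂ (inj₁ _)) = refl
        embed∘project (inj₂ (inj₂ _)) = refl
        ι : Nodeˢ (S₁ ⊕ S₂) → V
        ι (inj₁ u) = inj₁ (inj₂ u)
        ι (inj₂ u) = inj₂ u
        embed-leaf : ∀ x → embed (ι (leafNodeˢ x)) ≡ leafNodeˢ (LeafIso.to ∧-leaves x)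
        embed-leaf (inj₁ (inj₁ _)) = refl
        embed-leaf (inj₂ (inj₁ _)) = refl
        embed-leaf (inj₁ (inj₂ _)) = refl
        embed-leaf (inj₂ (inj₂ _)) = refl
        project-leaf : ∀ y → project (leafNodeˢ y) ≡ ι (leafNodeˢ (LeafIso.from ∧-leaves y))
        project-leaf (inj₁ (∧l _))   = refl
        project-leaf (inj₁ (∧r _))   = refl
        project-leaf (inj₂ (inj₁ _)) = refl
        project-leaf (inj₂ (inj₂ _)) = refl
        edge₁ : ∀ {u v} → TEdgeˢ S₁ (sX , s₁) u v → TEdgeˢ T t (embed (inj₁ (inj₂ u))) (embed (inj₁ (inj₂ v)))
        edge₁ {inj₁ _} {inj₁ _} e = ∧l e
        edge₁ {inj₂ _} {inj₂ _} e = e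
        edge₂ : ∀ {u v} → TEdgeˢ S₂ (sY , s₂) u v → TEdgeˢ T t (embed (inj₂ u)) (embed (inj₂ v))
        edge₂ {inj₁ _} {inj₁ _} e = ∧r e
        edge₂ {inj₂ _} {inj₂ _} e = e
        hom : ∀ {w w′} → B₂.Edge w w′ → Adjˢ T (transportLinking ∧-leaves ax) t (embed w) (embed w′)
        hom (inside₁ (inside₂ {u} {v} (inj₁ e)))        = inj₁ (edge₁ {u} {v} e)
        hom (inside₁ (inside₂ {u} {v} (inj₂ (inj₁ e)))) = inj₂ (inj₁ (edge₁ {v} {u} e))
        hom (inside₁ (inside₂ (inj₂ (inj₂ (z , refl , refl))))) =
          inj₂ (inj₂ (axiomEdge-preserve ∧-leaves ax ι embed embed-leaf (inj₁ z)))
        hom (inside₁ across)                     = inj₁ ∧-left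
        hom (inside₁ back)                       = inj₂ (inj₁ ∧-left)
        hom (inside₂ {u} {v} (inj₁ e))           = inj₁ (edge₂ {u} {v} e)
        hom (inside₂ {u} {v} (inj₂ (inj₁ e)))    = inj₂ (inj₁ (edge₂ {v} {u} e))
        hom (inside₂ (inj₂ (inj₂ (z , refl , refl)))) =
          inj₂ (inj₂ (axiomEdge-preserve ∧-leaves ax ι embed embed-leaf (inj₂ z)))
        hom across                               = inj₁ ∧-right
        hom back                                 = inj₂ (inj₁ ∧-right)
        edge⁻ : ∀ {u v} → TEdgeˢ T t u v → B₂.Edge (project u) (project v)
        edge⁻ {inj₁ _} {inj₁ _} ∧-left                  = inside₁ across
        edge⁻ {inj₁ _} {inj₁ _} ∧-right                 = across
        edge⁻ {inj₁ _} {inj₁ _} (∧l e)                  = inside₁ (inside₂ (inj₁ e))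
        edge⁻ {inj₁ _} {inj₁ _} (∧r e)                  = inside₂ (inj₁ e)
        edge⁻ {inj₂ (inj₁ _)} {inj₂ (inj₁ _)} e         = inside₁ (inside₂ (inj₁ e))
        edge⁻ {inj₂ (inj₂ _)} {inj₂ (inj₂ _)} e         = inside₂ (inj₁ e)
        linked : ∀ x → B₂.Edge (ι (leafNodeˢ x)) (ι (leafNodeˢ (link ax x)))
        linked (inj₁ z) = inside₁ (inside₂ (inj₂ (inj₂ (z , refl , refl))))
        linked (inj₂ z) = inside₂ (inj₂ (inj₂ (z , refl , refl)))
        hom⁻ : ∀ {w w′} → Adjˢ T (transportLinking ∧-leaves ax) t w w′ → B₂.Edge (project w) (project w′)
        hom⁻ (inj₁ e)        = edge⁻ e
        hom⁻ (inj₂ (inj₁ e)) =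
          B₂.Edge-sym (B₁.Edge-sym (λ ()) (Adjˢ-sym {ax = ax₁})) (Adjˢ-sym {ax = ax₂}) (edge⁻ e)
        hom⁻ (inj₂ (inj₂ a)) = axiomEdge-reflect ∧-leaves ax ι {B₂.Edge} project project-leaf linked a

module CliqueMaps where

  open Equivalence using (to; from)

  CliqueMap : Formula → Formula → Set₁
  CliqueMap D F = Σ[ f ∈ (Leaf D → Leaf F) ] (LabelPreserving f × CliquePreserving f)

  CliqueMap-refl : ∀ {A} → CliqueMap A A
  CliqueMap-refl = (λ x → x) , (λ _ → refl) , λ L (r , L⇔r) →
    r , λ y → mk⇔ (λ { (x , Lx , refl) → to (L⇔r x) Lx }) (λ i → y , from (L⇔r y) i , refl)

  CliqueMap-∨ˡ : ∀ {D B C} → CliqueMap D B → CliqueMap D (B ∨ᶠ C)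
  CliqueMap-∨ˡ (f , label-f , clique-f) = (λ x → ∨l (f x)) , label-f , clique
    where
    clique : CliquePreserving (λ x → ∨l (f x))
    clique L L-clique with clique-f L L-clique
    ... | r , img⇔r = inj₁ r , λ where
      (∨l y) → mk⇔ (λ { (x , Lx , refl) → ∨l (to (img⇔r y) (x , Lx , refl)) })
                   (λ { (∨l i) → let (x , Lx , fx≡y) = from (img⇔r y) i in x , Lx , cong ∨l fx≡y })
      (∨r y) → mk⇔ (λ { (_ , _ , ()) }) (λ ())

  CliqueMap-∨ʳ : ∀ {D B C} → CliqueMap D C → CliqueMap D (B ∨ᶠ C)
  CliqueMap-∨ʳ (f , label-f , clique-f) = (λ x → ∨r (f x)) , label-f , clique
    where
    clique : CliquePreserving (λ x → ∨r (f x))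
    clique L L-clique with clique-f L L-clique
    ... | r , img⇔r = inj₂ r , λ where
      (∨r y) → mk⇔ (λ { (x , Lx , refl) → ∨r (to (img⇔r y) (x , Lx , refl)) })
                   (λ { (∨r i) → let (x , Lx , fx≡y) = from (img⇔r y) i in x , Lx , cong ∨r fx≡y })
      (∨l y) → mk⇔ (λ { (_ , _ , ()) }) (λ ())

  module _ {A B : Formula} {L : Leaf (A ∨ᶠ B) → Set} where

    restrict-∨ˡ : ∀ {r} → (∀ x → L x ⇔ InRes (A ∨ᶠ B) (inj₁ r) x) → ∀ x → L (∨l x) ⇔ InRes A r x
    restrict-∨ˡ L⇔r x = mk⇔ (λ Lx → unwrap (to (L⇔r (∨l x)) Lx)) (λ i → from (L⇔r (∨l x)) (∨l i))
      where
      unwrap : ∀ {r} → InRes (A ∨ᶠ B) (inj₁ r) (∨l x) → InRes A r x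
      unwrap (∨l i) = i

    restrict-∨ʳ : ∀ {r} → (∀ x → L x ⇔ InRes (A ∨ᶠ B) (inj₂ r) x) → ∀ x → L (∨r x) ⇔ InRes B r x
    restrict-∨ʳ L⇔r x = mk⇔ (λ Lx → unwrap (to (L⇔r (∨r x)) Lx)) (λ i → from (L⇔r (∨r x)) (∨r i))
      where
      unwrap : ∀ {r} → InRes (A ∨ᶠ B) (inj₂ r) (∨r x) → InRes B r x
      unwrap (∨r i) = i

  module _ {A B : Formula} {L : Leaf (A ∧ᶠ B) → Set} {r s} (L⇔rs : ∀ x → L x ⇔ InRes (A ∧ᶠ B) (r , s) x) where

    restrict-∧ˡ : ∀ x → L (∧l x) ⇔ InRes A r x
    restrict-∧ˡ x = mk⇔ (λ Lx → unwrap (to (L⇔rs (∧l x)) Lx)) (λ i → from (L⇔rs (∧l x)) (∧l i))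
      where
      unwrap : InRes (A ∧ᶠ B) (r , s) (∧l x) → InRes A r x
      unwrap (∧l i) = i

    restrict-∧ʳ : ∀ x → L (∧r x) ⇔ InRes B s x
    restrict-∧ʳ x = mk⇔ (λ Lx → unwrap (to (L⇔rs (∧r x)) Lx)) (λ i → from (L⇔rs (∧r x)) (∧r i))
      where
      unwrap : InRes (A ∧ᶠ B) (r , s) (∧r x) → InRes B s x
      unwrap (∧r i) = i

  CliqueMap-contract : ∀ {D₁ D₂ F} → CliqueMap D₁ F → CliqueMap D₂ F → CliqueMap (D₁ ∨ᶠ D₂) F
  CliqueMap-contract {D₁} {D₂} {F} (f , label-f , clique-f) (g , label-g , clique-g) = h , label-h , clique
    where
    h : Leaf (D₁ ∨ᶠ D₂) → Leaf F
    h (∨l x) = f x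
    h (∨r x) = g x
    label-h : LabelPreserving h
    label-h (∨l x) = label-f x
    label-h (∨r x) = label-g x
    clique : CliquePreserving h
    clique L (inj₁ r , L⇔r) with clique-f (λ x → L (∨l x)) (r , restrict-∨ˡ L⇔r)
    ... | r′ , img⇔r′ = r′ , λ y → mk⇔ (λ m → to (img⇔r′ y) (onLeft m)) λ i →
            let (x , Lx , fx≡y) = from (img⇔r′ y) i in ∨l x , Lx , fx≡y
      where
      onLeft : ∀ {y} → image h L y → image f (λ x → L (∨l x)) y
      onLeft (∨l x , Lx , hx≡y) = x , Lx , hx≡y
      onLeft (∨r x , Lx , _) with to (L⇔r (∨r x)) Lx
      ... | ()
    clique L (inj₂ r , L⇔r) with clique-g (λ x → L (∨r x)) (r , restrict-∨ʳ L⇔r)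
    ... | r′ , img⇔r′ = r′ , λ y → mk⇔ (λ m → to (img⇔r′ y) (onRight m)) λ i →
            let (x , Lx , gx≡y) = from (img⇔r′ y) i in ∨r x , Lx , gx≡y
      where
      onRight : ∀ {y} → image h L y → image g (λ x → L (∨r x)) y
      onRight (∨r x , Lx , hx≡y) = x , Lx , hx≡y
      onRight (∨l x , Lx , _) with to (L⇔r (∨l x)) Lx
      ... | ()

  CliqueMap-∧ : ∀ {D₁ D₂ B C} → CliqueMap D₁ B → CliqueMap D₂ C → CliqueMap (D₁ ∧ᶠ D₂) (B ∧ᶠ C)
  CliqueMap-∧ {D₁} {D₂} {B} {C} (f , label-f , clique-f) (g , label-g , clique-g) = h , label-h , clique
    where
    h : Leaf (D₁ ∧ᶠ D₂) → Leaf (B ∧ᶠ C)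
    h (∧l x) = ∧l (f x)
    h (∧r x) = ∧r (g x)
    label-h : LabelPreserving h
    label-h (∧l x) = label-f x
    label-h (∧r x) = label-g x
    clique : CliquePreserving h
    clique L ((r , s) , L⇔rs)
      with clique-f (λ x → L (∧l x)) (r , restrict-∧ˡ L⇔rs) | clique-g (λ x → L (∧r x)) (s , restrict-∧ʳ L⇔rs)
    ... | r′ , img⇔r′ | s′ , img⇔s′ = (r′ , s′) , λ where
      (∧l y) → mk⇔ (λ { (∧l x , Lx , refl) → ∧l (to (img⇔r′ y) (x , Lx , refl)) ; (∧r _ , _ , ()) })
                   (λ { (∧l i) → let (x , Lx , fx≡y) = from (img⇔r′ y) i in ∧l x , Lx , cong ∧l fx≡y })
      (∧r y) → mk⇔ (λ { (∧r x , Lx , refl) → ∧r (to (img⇔s′ y) (x , Lx , refl)) ; (∧l _ , _ , ()) })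
                   (λ { (∧r i) → let (x , Lx , gx≡y) = from (img⇔s′ y) i in ∧r x , Lx , cong ∧r gx≡y })

  TrueClique : Valuation → ∀ A → Resolution A → Set
  TrueClique v A r = ∀ x → InRes A r x → evalLit v (label x) ≡ true

  true⇒trueClique : ∀ v A → eval v A ≡ true → Σ[ r ∈ Resolution A ] TrueClique v A r
  true⇒trueClique v (lit _) l-true = tt , λ { here here → l-true }
  true⇒trueClique v (A ∧ᶠ B) _ with eval v A in A-true | eval v B in B-true
  ... | true | true with true⇒trueClique v A A-true | true⇒trueClique v B B-true
  ...   | r , r-true | s , s-true = (r , s) , λ { (∧l x) (∧l i) → r-true x i ; (∧r x) (∧r i) → s-true x i }
  true⇒trueClique v (A ∨ᶠ B) B-true with eval v A in A-true
  ... | true with true⇒trueClique v A A-true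
  ...   | r , r-true = inj₁ r , λ { (∨l x) (∨l i) → r-true x i }
  true⇒trueClique v (A ∨ᶠ B) B-true | false with true⇒trueClique v B B-true
  ...   | s , s-true = inj₂ s , λ { (∨r x) (∨r i) → s-true x i }

  trueClique⇒true : ∀ v A r → TrueClique v A r → eval v A ≡ true
  trueClique⇒true v (lit _) _ r-true = r-true here here
  trueClique⇒true v (A ∧ᶠ B) (r , s) rs-true =
    cong₂ _∧_ (trueClique⇒true v A r (λ x i → rs-true (∧l x) (∧l i))) (trueClique⇒true v B s (λ x i → rs-true (∧r x) (∧r i)))
  trueClique⇒true v (A ∨ᶠ B) (inj₁ r) r-true =
    cong (_∨ eval v B) (trueClique⇒true v A r (λ x i → r-true (∨l x) (∨l i)))
  trueClique⇒true v (A ∨ᶠ B) (inj₂ s) s-true =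
    trans (cong (eval v A ∨_) (trueClique⇒true v B s (λ x i → s-true (∨r x) (∨r i)))) (∨-zeroʳ (eval v A))

  CliqueMap-valid : ∀ {D F} → CliqueMap D F → Valid D → Valid F
  CliqueMap-valid {D} {F} (f , label-f , clique-f) valid v with true⇒trueClique v D (valid v)
  ... | r , r-true with clique-f (InRes D r) (r , λ _ → mk⇔ (λ i → i) (λ i → i))
  ... | s , img⇔s = trueClique⇒true v F s s-true
    where
    s-true : TrueClique v F s
    s-true y i with from (img⇔s y) i
    ... | x , x∈r , refl = trans (cong (evalLit v) (label-f x)) (r-true x x∈r)

module Completeness where

  open ProofStructure
  open CliqueMaps

  data Every (P : Formula → Set₁) : Sequent → Set₁ where
    ⟨_⟩ : ∀ {A} → P A → Every P ⟨ A ⟩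
    ∅   : Every P ∅
    _⊕_ : ∀ {S T} → Every P S → Every P T → Every P (S ⊕ T)

  Every-map : ∀ {P Q : Formula → Set₁} → (∀ {A} → P A → Q A) → ∀ {S} → Every P S → Every Q S
  Every-map f ⟨ p ⟩   = ⟨ f p ⟩
  Every-map f ∅       = ∅
  Every-map f (p ⊕ q) = Every-map f p ⊕ Every-map f q

  infix 3 _≈_

  data _≈_ : Sequent → Sequent → Set where
    ≈-refl       : ∀ {S} → S ≈ S
    ≈-comm       : ∀ {S T} → (S ⊕ T) ≈ (T ⊕ S)
    ≈-assoc      : ∀ {S T U} → ((S ⊕ T) ⊕ U) ≈ (S ⊕ (T ⊕ U))
    ≈-identityˡ  : ∀ {S} → (∅ ⊕ S) ≈ S
    ≈-identityˡ⁻ : ∀ {S} → S ≈ (∅ ⊕ S)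
    ≈-congˡ      : ∀ {S S′ T} → S ≈ S′ → (S ⊕ T) ≈ (S′ ⊕ T)
    ≈-trans      : ∀ {S T U} → S ≈ T → T ≈ U → S ≈ U

  ≈-congʳ : ∀ {S T T′} → T ≈ T′ → (S ⊕ T) ≈ (S ⊕ T′)
  ≈-congʳ r = ≈-trans ≈-comm (≈-trans (≈-congˡ r) ≈-comm)

  ≈-assocˡ : ∀ {S T U} → (S ⊕ (T ⊕ U)) ≈ ((S ⊕ T) ⊕ U)
  ≈-assocˡ = ≈-trans ≈-comm (≈-trans ≈-assoc (≈-trans ≈-comm (≈-trans ≈-assoc ≈-comm)))

  ≈-identityʳ : ∀ {S} → (S ⊕ ∅) ≈ S
  ≈-identityʳ = ≈-trans ≈-comm ≈-identityˡ

  ≈-identityʳ⁻ : ∀ {S} → S ≈ (S ⊕ ∅)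
  ≈-identityʳ⁻ = ≈-trans ≈-identityˡ⁻ ≈-comm

  ≈-swapˡ : ∀ {S T U} → (S ⊕ (T ⊕ U)) ≈ (T ⊕ (S ⊕ U))
  ≈-swapˡ = ≈-trans ≈-assocˡ (≈-trans (≈-congˡ ≈-comm) ≈-assoc)

  ≈-interchange : ∀ {S T U W} → ((S ⊕ T) ⊕ (U ⊕ W)) ≈ ((S ⊕ U) ⊕ (T ⊕ W))
  ≈-interchange = ≈-trans ≈-assoc (≈-trans (≈-congʳ ≈-swapˡ) ≈-assocˡ)

  ≈⇒≅ : ∀ {S T} → S ≈ T → S ≅ T
  ≈⇒≅ ≈-refl        = ≅-refl
  ≈⇒≅ ≈-comm        = ⊕-comm
  ≈⇒≅ ≈-assoc       = ⊕-assoc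
  ≈⇒≅ ≈-identityˡ   = ∅-identityˡ
  ≈⇒≅ ≈-identityˡ⁻  = ∅-identityˡ⁻
  ≈⇒≅ (≈-congˡ r)   = ⊕-congˡ (≈⇒≅ r)
  ≈⇒≅ (≈-trans r q) = ≅-trans (≈⇒≅ r) (≈⇒≅ q)

  Net-rearrange : ∀ {S T} → S ≈ T → Net S → Net T
  Net-rearrange r = Net-transport (≈⇒≅ r)

  Every-rearrange : ∀ {P S T} → S ≈ T → Every P S → Every P T
  Every-rearrange ≈-refl          p             = p
  Every-rearrange ≈-comm          (p ⊕ q)       = q ⊕ p
  Every-rearrange ≈-assoc         ((p ⊕ q) ⊕ r) = p ⊕ (q ⊕ r)
  Every-rearrange ≈-identityˡ     (∅ ⊕ p)       = p
  Every-rearrange ≈-identityˡ⁻    p             = ∅ ⊕ p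
  Every-rearrange (≈-congˡ r)     (p ⊕ q)       = Every-rearrange r p ⊕ q
  Every-rearrange (≈-trans r₁ r₂) p             = Every-rearrange r₂ (Every-rearrange r₁ p)

  data ∅-Free : Sequent → Set where
    ⟨⟩-free : ∀ {A} → ∅-Free ⟨ A ⟩
    ⊕-free  : ∀ {S T} → ∅-Free S → ∅-Free T → ∅-Free (S ⊕ T)

  data Normal : Sequent → Set where
    ∅-normal    : Normal ∅
    free-normal : ∀ {S} → ∅-Free S → Normal S

  ∅-Free-node : ∀ {S} → ∅-Free S → Nodeˢ S
  ∅-Free-node ⟨⟩-free      = root
  ∅-Free-node (⊕-free f _) = inj₁ (∅-Free-node f)

  ∅-Free-≉∅⊕∅ : ∀ {S} → ∅-Free S → ¬ (S ≈ ∅ ⊕ ∅)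
  ∅-Free-≉∅⊕∅ free r with _≅_.node (≈⇒≅ r) (∅-Free-node free)
  ... | inj₁ ()
  ... | inj₂ ()

  normalise-⊕ : ∀ {S T} → Normal S → Normal T → Σ[ U ∈ Sequent ] (Normal U × (S ⊕ T) ≈ U)
  normalise-⊕ ∅-normal        n                = _ , n , ≈-identityˡ
  normalise-⊕ (free-normal f) ∅-normal         = _ , free-normal f , ≈-identityʳ
  normalise-⊕ (free-normal f) (free-normal f′) = _ , free-normal (⊕-free f f′) , ≈-refl

  record Partition (P Q : Formula → Set₁) (S : Sequent) : Set₁ where
    constructor partitioned
    field
      {Sᴾ Sᑫ}  : Sequent
      normalᴾ : Normal Sᴾ
      normalᑫ : Normal Sᑫ
      split   : S ≈ (Sᴾ ⊕ Sᑫ)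
      everyᴾ  : Every P Sᴾ
      everyᑫ  : Every Q Sᑫ

  partition : ∀ {P Q R : Formula → Set₁} → (∀ {A} → R A → P A ⊎ Q A) →
              ∀ {S} → ∅-Free S → Every R S → Partition P Q S
  partition classify ⟨⟩-free ⟨ r ⟩ with classify r
  ... | inj₁ p = partitioned (free-normal ⟨⟩-free) ∅-normal ≈-identityʳ⁻ ⟨ p ⟩ ∅
  ... | inj₂ q = partitioned ∅-normal (free-normal ⟨⟩-free) ≈-identityˡ⁻ ∅ ⟨ q ⟩
  partition classify (⊕-free f₁ f₂) (r₁ ⊕ r₂)
    with partition classify f₁ r₁ | partition classify f₂ r₂
  ... | partitioned nP₁ nQ₁ split₁ p₁ q₁ | partitioned nP₂ nQ₂ split₂ p₂ q₂
    with normalise-⊕ nP₁ nP₂ | normalise-⊕ nQ₁ nQ₂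
  ... | _ , nP , rP | _ , nQ , rQ =
    partitioned nP nQ
      (≈-trans (≈-congˡ split₁) (≈-trans (≈-congʳ split₂)
        (≈-trans ≈-interchange (≈-trans (≈-congˡ rP) (≈-congʳ rQ)))))
      (Every-rearrange rP (p₁ ⊕ p₂)) (Every-rearrange rQ (q₁ ⊕ q₂))

  contract : ∀ {F S R} → ∅-Free S → Net (S ⊕ R) → Every (λ D → CliqueMap D F) S →
             Σ[ X ∈ Formula ] (Net (⟨ X ⟩ ⊕ R) × CliqueMap X F)
  contract {S = ⟨ D ⟩} ⟨⟩-free n ⟨ m ⟩ = D , n , m
  contract (⊕-free f₁ f₂) n (m₁ ⊕ m₂) with contract f₁ (Net-rearrange ≈-assoc n) m₁
  ... | X₁ , n₁ , m₁′ with contract f₂ (Net-rearrange ≈-swapˡ n₁) m₂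
  ... | X₂ , n₂ , m₂′ =
    X₁ ∨ᶠ X₂ , ∨-net (Net-rearrange (≈-trans ≈-swapˡ ≈-assocˡ) n₂) , CliqueMap-contract m₁′ m₂′

  data Occurs (Ls : List Lit) (Γ : List Formula) : Formula → Set where
    literal : ∀ {l} → l ∈ Ls → Occurs Ls Γ (lit l)
    formula : ∀ {F} → F ∈ Γ → Occurs Ls Γ F

  MapsInto : List Lit → List Formula → Formula → Set₁
  MapsInto Ls Γ D = Σ[ F ∈ Formula ] (Occurs Ls Γ F × CliqueMap D F)

  -- Ls collects the literals already split off Γ; every conclusion of the net is mapped onto one of them
  -- or onto a formula of Γ.
  SequentProof : List Lit → List Formula → Set₁
  SequentProof Ls Γ = Σ[ S ∈ Sequent ] (∅-Free S × Net S × Every (MapsInto Ls Γ) S)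

  module _ {Ls Ls′ Γ Γ′} (f : ∀ {D} → MapsInto Ls Γ D → MapsInto Ls′ Γ′ D) where

    retarget : SequentProof Ls Γ → SequentProof Ls′ Γ′
    retarget (S , free , n , m) = S , free , n , Every-map f m

  withoutHead : ∀ {Ls Γ S Sᑫ} → ∅-Free S → Net S → S ≈ (∅ ⊕ Sᑫ) → Normal Sᑫ → Every (MapsInto Ls Γ) Sᑫ →
                SequentProof Ls Γ
  withoutHead free n split ∅-normal        _ = ⊥-elim (∅-Free-≉∅⊕∅ free split)
  withoutHead free n split (free-normal f) m = _ , f , Net-rearrange (≈-trans split ≈-identityˡ) n , m

  withHead : ∀ {Ls Γ X Sᑫ} → Normal Sᑫ → Net (⟨ X ⟩ ⊕ Sᑫ) → MapsInto Ls Γ X → Every (MapsInto Ls Γ) Sᑫ →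
             SequentProof Ls Γ
  withHead ∅-normal        n mX _  = _ , ⟨⟩-free , Net-rearrange ≈-identityʳ n , ⟨ mX ⟩
  withHead (free-normal f) n mX mᑫ = _ , ⊕-free ⟨⟩-free f , n , ⟨ mX ⟩ ⊕ mᑫ

  module _ {Ls : List Lit} {Γ : List Formula} where

    axiom-rule : ∀ {l} → l ∈ Ls → dual l ∈ Ls → SequentProof Ls Γ
    axiom-rule {l} l∈ l̄∈ =
      _ , ⊕-free ⟨⟩-free ⟨⟩-free , axiom-net l ,
      ⟨ lit l , literal l∈ , CliqueMap-refl ⟩ ⊕ ⟨ lit (dual l) , literal l̄∈ , CliqueMap-refl ⟩

    lit-rule : ∀ {l} → SequentProof (l ∷ Ls) Γ → SequentProof Ls (lit l ∷ Γ)
    lit-rule = retarget λ where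
      (F , literal (here refl) , m) → F , formula (here refl) , m
      (F , literal (there l∈) , m)  → F , literal l∈ , m
      (F , formula F∈ , m)          → F , formula (there F∈) , m

    ∨-rule : ∀ {B C} → SequentProof Ls (B ∷ C ∷ Γ) → SequentProof Ls ((B ∨ᶠ C) ∷ Γ)
    ∨-rule {B} {C} = retarget λ where
      (_ , formula (here refl) , m)         → B ∨ᶠ C , formula (here refl) , CliqueMap-∨ˡ m
      (_ , formula (there (here refl)) , m) → B ∨ᶠ C , formula (here refl) , CliqueMap-∨ʳ m
      (F , formula (there (there F∈)) , m)  → F , formula (there F∈) , m
      (F , literal l∈ , m)                  → F , literal l∈ , m

    weaken : ∀ {D B} → MapsInto Ls Γ D → MapsInto Ls (B ∷ Γ) D
    weaken (F , formula F∈ , m) = F , formula (there F∈) , m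
    weaken (F , literal l∈ , m) = F , literal l∈ , m

    byHead : ∀ {D B} → MapsInto Ls (B ∷ Γ) D → CliqueMap D B ⊎ MapsInto Ls Γ D
    byHead (_ , formula (here refl) , m) = inj₁ m
    byHead (F , formula (there F∈) , m)  = inj₂ (F , formula F∈ , m)
    byHead (F , literal l∈ , m)          = inj₂ (F , literal l∈ , m)

    -- Conclusions mapped onto B (resp. C) are contracted into one formula X (resp. Y) before the tensor;
    -- if there are none, the premise already proves the conclusion by weakening.
    ∧-rule : ∀ {B C} → SequentProof Ls (B ∷ Γ) → SequentProof Ls (C ∷ Γ) → SequentProof Ls ((B ∧ᶠ C) ∷ Γ)
    ∧-rule {B} {C} (_ , free₁ , n₁ , m₁) (_ , free₂ , n₂ , m₂)
      with partition byHead free₁ m₁ | partition byHead free₂ m₂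
    ... | partitioned ∅-normal nᑫ split _ mᑫ | _ = retarget weaken (withoutHead free₁ n₁ split nᑫ mᑫ)
    ... | _ | partitioned ∅-normal nᑫ split _ mᑫ = retarget weaken (withoutHead free₂ n₂ split nᑫ mᑫ)
    ... | partitioned (free-normal f₁) nᑫ₁ split₁ mB mᑫ₁ | partitioned (free-normal f₂) nᑫ₂ split₂ mC mᑫ₂
      with contract f₁ (Net-rearrange split₁ n₁) mB | contract f₂ (Net-rearrange split₂ n₂) mC | normalise-⊕ nᑫ₁ nᑫ₂
    ... | X , nX , mX | Y , nY , mY | _ , nᑫ , rᑫ =
      withHead nᑫ (Net-rearrange (≈-congʳ rᑫ) (∧-net nX nY)) (B ∧ᶠ C , formula (here refl) , CliqueMap-∧ mX mY)
        (Every-rearrange rᑫ (Every-map weaken mᑫ₁ ⊕ Every-map weaken mᑫ₂))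

  Holds : Valuation → List Lit → List Formula → Set
  Holds v Ls Γ = Any (λ l → evalLit v l ≡ true) Ls ⊎ Any (λ F → eval v F ≡ true) Γ

  ValidSequent : List Lit → List Formula → Set
  ValidSequent Ls Γ = ∀ v → Holds v Ls Γ

  private
    ∨-true : ∀ {a b} → a Bool.∨ b ≡ true → a ≡ true ⊎ b ≡ true
    ∨-true {true}  _   = inj₁ refl
    ∨-true {false} b≡t = inj₂ b≡t

    ∧-trueˡ : ∀ {a b} → a Bool.∧ b ≡ true → a ≡ true
    ∧-trueˡ {true} _ = refl

    ∧-trueʳ : ∀ {a b} → a Bool.∧ b ≡ true → b ≡ true
    ∧-trueʳ {true} b≡t = b≡t

  module _ {Ls : List Lit} {Γ : List Formula} where

    ValidSequent-lit : ∀ {l} → ValidSequent Ls (lit l ∷ Γ) → ValidSequent (l ∷ Ls) Γ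
    ValidSequent-lit valid v with valid v
    ... | inj₁ l∈         = inj₁ (there l∈)
    ... | inj₂ (here l≡)  = inj₁ (here l≡)
    ... | inj₂ (there F∈) = inj₂ F∈

    ValidSequent-∨ : ∀ {B C} → ValidSequent Ls ((B ∨ᶠ C) ∷ Γ) → ValidSequent Ls (B ∷ C ∷ Γ)
    ValidSequent-∨ {B} valid v with valid v
    ... | inj₁ l∈         = inj₁ l∈
    ... | inj₂ (here B∨C) = inj₂ (⊎.[ here , (λ C≡ → there (here C≡)) ]′ (∨-true {eval v B} B∨C))
    ... | inj₂ (there F∈) = inj₂ (there (there F∈))

    ValidSequent-∧ˡ : ∀ {B C} → ValidSequent Ls ((B ∧ᶠ C) ∷ Γ) → ValidSequent Ls (B ∷ Γ)
    ValidSequent-∧ˡ valid v with valid v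
    ... | inj₁ l∈         = inj₁ l∈
    ... | inj₂ (here B∧C) = inj₂ (here (∧-trueˡ B∧C))
    ... | inj₂ (there F∈) = inj₂ (there F∈)

    ValidSequent-∧ʳ : ∀ {B C} → ValidSequent Ls ((B ∧ᶠ C) ∷ Γ) → ValidSequent Ls (C ∷ Γ)
    ValidSequent-∧ʳ {B} valid v with valid v
    ... | inj₁ l∈         = inj₁ l∈
    ... | inj₂ (here B∧C) = inj₂ (here (∧-trueʳ {eval v B} B∧C))
    ... | inj₂ (there F∈) = inj₂ (there F∈)

  _≟ᴸ_ : DecidableEquality Lit
  mkLit x b ≟ᴸ mkLit y c =
    map′ (λ (x≡y , b≡c) → cong₂ mkLit x≡y b≡c) (λ { refl → refl , refl }) (x ℕ.≟ y ×-dec b Bool.≟ c)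

  open import Data.List.Membership.DecPropositional _≟ᴸ_ using (_∈?_)

  -- Without a complementary pair, making every literal of Ls false is a consistent valuation.
  complementaryPair : ∀ {Ls} → ValidSequent Ls [] → Σ[ l ∈ Lit ] (l ∈ Ls × dual l ∈ Ls)
  complementaryPair {Ls} valid with any? (λ l → dual l ∈? Ls) Ls
  ... | yes pair = find pair
  ... | no noPair = ⊥-elim (refuted (valid v))
    where
    v : Valuation
    v x = does (mkLit x false ∈? Ls)
    false-on-Ls : ∀ {l} → l ∈ Ls → evalLit v l ≡ false
    false-on-Ls {mkLit x true} l∈ with mkLit x false ∈? Ls
    ... | yes l̄∈ = ⊥-elim (noPair (lose l∈ l̄∈))
    ... | no _   = refl
    false-on-Ls {mkLit x false} l∈ with mkLit x false ∈? Ls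
    ... | yes _  = refl
    ... | no l∉  = ⊥-elim (l∉ l∈)
    refuted : ¬ Holds v Ls []
    refuted (inj₁ true-in-Ls) with find true-in-Ls
    ... | l , l∈ , l-true with trans (sym l-true) (false-on-Ls l∈)
    ...   | ()

  size : Formula → ℕ
  size (lit _)  = 1
  size (A ∧ᶠ B) = suc (size A + size B)
  size (A ∨ᶠ B) = suc (size A + size B)

  size* : List Formula → ℕ
  size* []      = 0
  size* (F ∷ Γ) = size F + size* Γ

  search : ∀ n {Ls Γ} → size* Γ < n → ValidSequent Ls Γ → SequentProof Ls Γ
  search (suc n) {Γ = []} _ valid with complementaryPair valid
  ... | _ , l∈ , l̄∈ = axiom-rule l∈ l̄∈
  search (suc n) {Γ = lit l ∷ Γ} (s≤s bound) valid = lit-rule (search n bound (ValidSequent-lit valid))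
  search (suc n) {Γ = (B ∨ᶠ C) ∷ Γ} (s≤s bound) valid =
    ∨-rule (search n (subst (_< n) (+-assoc (size B) (size C) (size* Γ)) bound) (ValidSequent-∨ valid))
  search (suc n) {Γ = (B ∧ᶠ C) ∷ Γ} (s≤s bound) valid =
    ∧-rule (search n (≤-trans (s≤s (+-monoˡ-≤ (size* Γ) (m≤m+n (size B) (size C)))) bound) (ValidSequent-∧ˡ valid))
           (search n (≤-trans (s≤s (+-monoˡ-≤ (size* Γ) (m≤n+m (size C) (size B)))) bound) (ValidSequent-∧ʳ valid))

  MapsInto-singleton : ∀ {A D} → MapsInto [] (A ∷ []) D → CliqueMap D A
  MapsInto-singleton (_ , formula (here refl) , m) = m

  completeness : ∀ A → Valid A → CombinatorialProof A
  completeness A valid with search _ {[]} {A ∷ []} ≤-refl (λ v → inj₂ (here (valid v)))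
  ... | _ , free , n , m with contract free (Net-rearrange ≈-identityʳ⁻ n) (Every-map MapsInto-singleton m)
  ... | X , nX , mX = X , Net⇒ProofNet (Net-rearrange ≈-identityʳ nX) , mX

module Navigation where

  isRoot : ∀ {A} → Node A → Bool
  isRoot root = true
  isRoot (∧l _) = false
  isRoot (∧r _) = false
  isRoot (∨l _) = false
  isRoot (∨r _) = false

  isRoot-true : ∀ {A} (u : Node A) → isRoot u ≡ true → u ≡ root
  isRoot-true root _ = refl

  -- parent root = root is a junk value: the lemmas about parent assume isRoot u ≡ false.
  parent : ∀ {A} → Node A → Node A
  parent root   = root
  parent (∧l u) = if isRoot u then root else ∧l (parent u)
  parent (∧r u) = if isRoot u then root else ∧r (parent u)
  parent (∨l u) = if isRoot u then root else ∨l (parent u)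
  parent (∨r u) = if isRoot u then root else ∨r (parent u)

  depth : ∀ {A} → Node A → ℕ
  depth root   = 0
  depth (∧l u) = suc (depth u)
  depth (∧r u) = suc (depth u)
  depth (∨l u) = suc (depth u)
  depth (∨r u) = suc (depth u)

  -- just true / just false: the node is the left / right argument of a ∨-vertex.
  orSide : ∀ {A} → Node A → Maybe Bool
  orSide root   = nothing
  orSide (∧l u) = if isRoot u then nothing else orSide u
  orSide (∧r u) = if isRoot u then nothing else orSide u
  orSide (∨l u) = if isRoot u then just true else orSide u
  orSide (∨r u) = if isRoot u then just false else orSide u

  leafAt : ∀ {A} → Node A → Maybe (Leaf A)
  leafAt {lit _}  root = just here
  leafAt {_ ∧ᶠ _} root = nothing
  leafAt {_ ∨ᶠ _} root = nothing
  leafAt (∧l u) = Maybe.map ∧l (leafAt u)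
  leafAt (∧r u) = Maybe.map ∧r (leafAt u)
  leafAt (∨l u) = Maybe.map ∨l (leafAt u)
  leafAt (∨r u) = Maybe.map ∨r (leafAt u)

  leftChild : ∀ {A} → Node A → Node A
  leftChild {lit _}  root = root
  leftChild {_ ∧ᶠ _} root = ∧l root
  leftChild {_ ∨ᶠ _} root = ∨l root
  leftChild (∧l u) = ∧l (leftChild u)
  leftChild (∧r u) = ∧r (leftChild u)
  leftChild (∨l u) = ∨l (leftChild u)
  leftChild (∨r u) = ∨r (leftChild u)

  switchingFrom : ∀ A → (Node A → Bool) → Switching A
  switchingFrom (lit _)  τ = tt
  switchingFrom (A ∧ᶠ B) τ = switchingFrom A (λ u → τ (∧l u)) , switchingFrom B (λ u → τ (∧r u))
  switchingFrom (A ∨ᶠ B) τ = τ root , switchingFrom A (λ u → τ (∨l u)) , switchingFrom B (λ u → τ (∨r u))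

  parent-depth : ∀ {A} (u : Node A) → isRoot u ≡ false → suc (depth (parent u)) ≡ depth u
  parent-depth (∧l u) _ with isRoot u in isRoot-u
  ... | true rewrite isRoot-true u isRoot-u = refl
  ... | false = cong suc (parent-depth u isRoot-u)
  parent-depth (∧r u) _ with isRoot u in isRoot-u
  ... | true rewrite isRoot-true u isRoot-u = refl
  ... | false = cong suc (parent-depth u isRoot-u)
  parent-depth (∨l u) _ with isRoot u in isRoot-u
  ... | true rewrite isRoot-true u isRoot-u = refl
  ... | false = cong suc (parent-depth u isRoot-u)
  parent-depth (∨r u) _ with isRoot u in isRoot-u
  ... | true rewrite isRoot-true u isRoot-u = refl
  ... | false = cong suc (parent-depth u isRoot-u)

  parent-notLeaf : ∀ {A} (u : Node A) → isRoot u ≡ false → leafAt (parent u) ≡ nothing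
  parent-notLeaf (∧l u) _ with isRoot u in isRoot-u
  ... | true  = refl
  ... | false = cong (Maybe.map ∧l) (parent-notLeaf u isRoot-u)
  parent-notLeaf (∧r u) _ with isRoot u in isRoot-u
  ... | true  = refl
  ... | false = cong (Maybe.map ∧r) (parent-notLeaf u isRoot-u)
  parent-notLeaf (∨l u) _ with isRoot u in isRoot-u
  ... | true  = refl
  ... | false = cong (Maybe.map ∨l) (parent-notLeaf u isRoot-u)
  parent-notLeaf (∨r u) _ with isRoot u in isRoot-u
  ... | true  = refl
  ... | false = cong (Maybe.map ∨r) (parent-notLeaf u isRoot-u)

  leafAt-just : ∀ {A} (u : Node A) {x} → leafAt u ≡ just x → u ≡ leafNode x
  leafAt-just {lit _} root refl = refl
  leafAt-just (∧l u) eq with leafAt u in leafAt-u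
  leafAt-just (∧l u) refl | just _ = cong ∧l (leafAt-just u leafAt-u)
  leafAt-just (∧r u) eq with leafAt u in leafAt-u
  leafAt-just (∧r u) refl | just _ = cong ∧r (leafAt-just u leafAt-u)
  leafAt-just (∨l u) eq with leafAt u in leafAt-u
  leafAt-just (∨l u) refl | just _ = cong ∨l (leafAt-just u leafAt-u)
  leafAt-just (∨r u) eq with leafAt u in leafAt-u
  leafAt-just (∨r u) refl | just _ = cong ∨r (leafAt-just u leafAt-u)

  leftChild-parent : ∀ {A} (u : Node A) → orSide u ≡ just true → leftChild (parent u) ≡ u
  leftChild-parent (∧l u) side with isRoot u in isRoot-u
  ... | false = cong ∧l (leftChild-parent u side)
  leftChild-parent (∧r u) side with isRoot u in isRoot-u
  ... | false = cong ∧r (leftChild-parent u side)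
  leftChild-parent (∨l u) side with isRoot u in isRoot-u
  ... | true rewrite isRoot-true u isRoot-u = refl
  ... | false = cong ∨l (leftChild-parent u side)
  leftChild-parent (∨r u) side with isRoot u in isRoot-u
  ... | false = cong ∨r (leftChild-parent u side)

  orSide-nonRoot : ∀ {A} (u : Node A) {b} → orSide u ≡ just b → isRoot u ≡ false
  orSide-nonRoot (∧l _) _ = refl
  orSide-nonRoot (∧r _) _ = refl
  orSide-nonRoot (∨l _) _ = refl
  orSide-nonRoot (∨r _) _ = refl

  leftSibling : ∀ {A} (u : Node A) → orSide u ≡ just false →
                orSide (leftChild (parent u)) ≡ just true × parent (leftChild (parent u)) ≡ parent u
  leftSibling (∧l u) side with isRoot u in isRoot-u
  ... | false with leftSibling u side
  ...   | isLeft , sameParent rewrite orSide-nonRoot (leftChild (parent u)) isLeft = isLeft , cong ∧l sameParent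
  leftSibling (∧r u) side with isRoot u in isRoot-u
  ... | false with leftSibling u side
  ...   | isLeft , sameParent rewrite orSide-nonRoot (leftChild (parent u)) isLeft = isLeft , cong ∧r sameParent
  leftSibling (∨l u) side with isRoot u in isRoot-u
  ... | false with leftSibling u side
  ...   | isLeft , sameParent rewrite orSide-nonRoot (leftChild (parent u)) isLeft = isLeft , cong ∨l sameParent
  leftSibling (∨r u) side with isRoot u in isRoot-u
  ... | true  = refl , refl
  ... | false with leftSibling u side
  ...   | isLeft , sameParent rewrite orSide-nonRoot (leftChild (parent u)) isLeft = isLeft , cong ∨r sameParent

  edgeFromParent : ∀ A (τ : Node A → Bool) (u : Node A) → isRoot u ≡ false →
                   (∀ {b} → orSide u ≡ just b → τ (parent u) ≡ b) → TEdge A (switchingFrom A τ) (parent u) u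
  edgeFromParent (A ∧ᶠ B) τ (∧l u) _ selects with isRoot u in isRoot-u
  ... | true rewrite isRoot-true u isRoot-u = ∧-left
  ... | false = ∧l (edgeFromParent A (λ w → τ (∧l w)) u isRoot-u selects)
  edgeFromParent (A ∧ᶠ B) τ (∧r u) _ selects with isRoot u in isRoot-u
  ... | true rewrite isRoot-true u isRoot-u = ∧-right
  ... | false = ∧r (edgeFromParent B (λ w → τ (∧r w)) u isRoot-u selects)
  edgeFromParent (A ∨ᶠ B) τ (∨l u) _ selects with isRoot u in isRoot-u
  ... | true rewrite isRoot-true u isRoot-u =
    subst (λ b → TEdge (A ∨ᶠ B) (b , proj₂ (switchingFrom (A ∨ᶠ B) τ)) root (∨l root)) (sym (selects refl)) ∨-left
  ... | false = ∨l (edgeFromParent A (λ w → τ (∨l w)) u isRoot-u selects)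
  edgeFromParent (A ∨ᶠ B) τ (∨r u) _ selects with isRoot u in isRoot-u
  ... | true rewrite isRoot-true u isRoot-u =
    subst (λ b → TEdge (A ∨ᶠ B) (b , proj₂ (switchingFrom (A ∨ᶠ B) τ)) root (∨r root)) (sym (selects refl)) ∨-right
  ... | false = ∨r (edgeFromParent B (λ w → τ (∨r w)) u isRoot-u selects)

  _≟ᴺ_ : ∀ {A} → DecidableEquality (Node A)
  root ≟ᴺ root = yes refl
  ∧l u ≟ᴺ ∧l v = map′ (cong ∧l) (λ { refl → refl }) (u ≟ᴺ v)
  ∧r u ≟ᴺ ∧r v = map′ (cong ∧r) (λ { refl → refl }) (u ≟ᴺ v)
  ∨l u ≟ᴺ ∨l v = map′ (cong ∨l) (λ { refl → refl }) (u ≟ᴺ v)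
  ∨r u ≟ᴺ ∨r v = map′ (cong ∨r) (λ { refl → refl }) (u ≟ᴺ v)
  root ≟ᴺ ∧l _ = no λ ()
  root ≟ᴺ ∧r _ = no λ ()
  root ≟ᴺ ∨l _ = no λ ()
  root ≟ᴺ ∨r _ = no λ ()
  ∧l _ ≟ᴺ root = no λ ()
  ∧l _ ≟ᴺ ∧r _ = no λ ()
  ∧r _ ≟ᴺ root = no λ ()
  ∧r _ ≟ᴺ ∧l _ = no λ ()
  ∨l _ ≟ᴺ root = no λ ()
  ∨l _ ≟ᴺ ∨r _ = no λ ()
  ∨r _ ≟ᴺ root = no λ ()
  ∨r _ ≟ᴺ ∨l _ = no λ ()

  allNodes : ∀ A → List (Node A)
  allNodes (lit _)  = root ∷ []
  allNodes (A ∧ᶠ B) = root ∷ map ∧l (allNodes A) ++ map ∧r (allNodes B)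
  allNodes (A ∨ᶠ B) = root ∷ map ∨l (allNodes A) ++ map ∨r (allNodes B)

  ∈-allNodes : ∀ A (u : Node A) → u ∈ allNodes A
  ∈-allNodes (lit _)  root   = here refl
  ∈-allNodes (_ ∧ᶠ _) root   = here refl
  ∈-allNodes (_ ∨ᶠ _) root   = here refl
  ∈-allNodes (A ∧ᶠ B) (∧l u) = there (∈-++⁺ˡ (∈-map⁺ ∧l (∈-allNodes A u)))
  ∈-allNodes (A ∧ᶠ B) (∧r u) = there (∈-++⁺ʳ (map ∧l (allNodes A)) (∈-map⁺ ∧r (∈-allNodes B u)))
  ∈-allNodes (A ∨ᶠ B) (∨l u) = there (∈-++⁺ˡ (∈-map⁺ ∨l (∈-allNodes A u)))
  ∈-allNodes (A ∨ᶠ B) (∨r u) = there (∈-++⁺ʳ (map ∨l (allNodes A)) (∈-map⁺ ∨r (∈-allNodes B u)))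

module Orbit where

  minimal : ∀ {P : ℕ → Set} → Decidable P → ∀ {n} → P n → Σ[ m ∈ ℕ ] (P m × (∀ {k} → k < m → ¬ P k))
  minimal {P} P? {n} p = below (suc n) (n , ≤-refl , p)
    where
    below : ∀ b → Σ[ k ∈ ℕ ] (k < b × P k) → Σ[ m ∈ ℕ ] (P m × (∀ {k} → k < m → ¬ P k))
    below (suc b) (k , k<1+b , pk) with anyUpTo? P? b
    ... | yes smaller = below b smaller
    ... | no none with m<1+n⇒m<n∨m≡n k<1+b
    ...   | inj₁ k<b  = ⊥-elim (none (k , k<b , pk))
    ...   | inj₂ refl = k , pk , λ j<k pj → none (_ , j<k , pj)

  module Iteration {V : Set} (_≟_ : DecidableEquality V) {elements : List V} (complete : ∀ v → v ∈ elements)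
                   (f : V → V) where

    iterate : ℕ → V → V
    iterate zero    x = x
    iterate (suc n) x = f (iterate n x)

    iterate-+ : ∀ m n x → iterate (m + n) x ≡ iterate n (iterate m x)
    iterate-+ m zero    x = cong (λ k → iterate k x) (+-identityʳ m)
    iterate-+ m (suc n) x = trans (cong (λ k → iterate k x) (+-suc m n)) (cong f (iterate-+ m n x))

    f-injectiveOnCycle : ∀ {z k} → iterate (suc k) z ≡ z →
                         ∀ a b → f (iterate a z) ≡ f (iterate b z) → iterate a z ≡ iterate b z
    f-injectiveOnCycle {z} {k} closes a b eq = begin
      iterate a z                     ≡⟨ back a ⟩
      iterate k (f (iterate a z))     ≡⟨ cong (iterate k) eq ⟩
      iterate k (f (iterate b z))     ≡⟨ back b ⟨
      iterate b z                     ∎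
      where
      open ≡-Reasoning
      back : ∀ a → iterate a z ≡ iterate k (f (iterate a z))
      back a = begin
        iterate a z                       ≡⟨ cong (iterate a) closes ⟨
        iterate a (iterate (suc k) z)     ≡⟨ iterate-+ (suc k) a z ⟨
        iterate (suc k + a) z             ≡⟨ cong (λ n → iterate (suc n) z) (+-comm k a) ⟩
        iterate (suc a + k) z             ≡⟨ iterate-+ (suc a) k z ⟩
        iterate k (f (iterate a z))       ∎

    Repeats : V → ℕ → Set
    Repeats x j = Σ[ i ∈ ℕ ] (i < j × iterate i x ≡ iterate j x)

    repeats : ∀ x → ∃[ j ] Repeats x j
    repeats x with pigeonhole (n<1+n (length elements)) (λ j → index (complete (iterate (toℕ j) x)))
    ... | i , j , i<j , same-index =
      toℕ j , toℕ i , i<j ,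
      trans (lookup-index (complete _)) (trans (cong (lookup elements) same-index) (sym (lookup-index (complete _))))

    -- The first repetition of the orbit of x closes a cycle whose points are pairwise distinct.
    periodicPoint : V → Σ[ z ∈ V ] Σ[ k ∈ ℕ ]
      (iterate (suc k) z ≡ z × (∀ {a b} → a < suc k → b < suc k → iterate a z ≡ iterate b z → a ≡ b))
    periodicPoint x with repeats x
    ... | j , repeat-j with minimal (λ j → anyUpTo? (λ i → iterate i x ≟ iterate j x) j) repeat-j
    ... | _ , (i , i<j , same) , first with m≤n⇒∃[o]m+o≡n i<j
    ... | k , refl = iterate i x , k , closes , distinct
      where
      shift : ∀ a → iterate a (iterate i x) ≡ iterate (i + a) x
      shift a = sym (iterate-+ i a x)
      closes : iterate (suc k) (iterate i x) ≡ iterate i x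
      closes = trans (shift (suc k)) (trans (cong (λ n → iterate n x) (+-suc i k)) (sym same))
      earlier : ∀ {a b} → a < b → iterate a (iterate i x) ≡ iterate b (iterate i x) → Repeats x (i + b)
      earlier {a} {b} a<b eq = i + a , +-monoʳ-< i a<b , trans (sym (shift a)) (trans eq (shift b))
      bounded : ∀ {b} → b < suc k → i + b < suc i + k
      bounded {b} b<1+k = subst (i + b <_) (+-suc i k) (+-monoʳ-< i b<1+k)
      distinct : ∀ {a b} → a < suc k → b < suc k → iterate a (iterate i x) ≡ iterate b (iterate i x) → a ≡ b
      distinct {a} {b} a<1+k b<1+k eq with <-cmp a b
      ... | tri≈ _ a≡b _ = a≡b
      ... | tri< a<b _ _ = ⊥-elim (first (bounded b<1+k) (earlier a<b eq))
      ... | tri> _ _ b<a = ⊥-elim (first (bounded a<1+k) (earlier b<a (sym eq)))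

module Soundness where

  open Navigation
  open Orbit

  ∧Choice : Formula → Set
  ∧Choice (lit _)  = ⊤
  ∧Choice (A ∧ᶠ B) = Bool × ∧Choice A × ∧Choice B
  ∧Choice (A ∨ᶠ B) = ∧Choice A × ∧Choice B

  -- The ∧-resolution selected by a choice: keep the left argument of an ∧-vertex iff its Bool is true.
  inside : ∀ {A} → ∧Choice A → Node A → Bool
  inside _           root   = true
  inside (b , ρ , _) (∧l u) = if b then inside ρ u else false
  inside (b , _ , ρ) (∧r u) = if b then false else inside ρ u
  inside (ρ , _)     (∨l u) = inside ρ u
  inside (_ , ρ)     (∨r u) = inside ρ u

  descend : ∀ {A} → ∧Choice A → Node A → Node A
  descend {lit _}  _           root   = root
  descend {_ ∧ᶠ _} (b , _)     root   = if b then ∧l root else ∧r root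
  descend {_ ∨ᶠ _} _           root   = ∨l root
  descend          (_ , ρ , _) (∧l u) = ∧l (descend ρ u)
  descend          (_ , _ , ρ) (∧r u) = ∧r (descend ρ u)
  descend          (ρ , _)     (∨l u) = ∨l (descend ρ u)
  descend          (_ , ρ)     (∨r u) = ∨r (descend ρ u)

  inside-parent : ∀ {A} (ρ : ∧Choice A) (u : Node A) → inside ρ u ≡ true → inside ρ (parent u) ≡ true
  inside-parent ρ root _ = refl
  inside-parent (b , ρ , _) (∧l u) in-u with isRoot u
  ... | true  = refl
  ... | false with b
  ...   | true = inside-parent ρ u in-u
  inside-parent (b , _ , ρ) (∧r u) in-u with isRoot u
  ... | true  = refl
  ... | false with b
  ...   | false = inside-parent ρ u in-u
  inside-parent (ρ , _) (∨l u) in-u with isRoot u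
  ... | true  = refl
  ... | false = inside-parent ρ u in-u
  inside-parent (_ , ρ) (∨r u) in-u with isRoot u
  ... | true  = refl
  ... | false = inside-parent ρ u in-u

  inside-orChild : ∀ {A} (ρ : ∧Choice A) (u : Node A) {b} → orSide u ≡ just b →
                   inside ρ (parent u) ≡ true → inside ρ u ≡ true
  inside-orChild (c , ρ , _) (∧l u) side in-p with isRoot u
  ... | false with c
  ...   | true = inside-orChild ρ u side in-p
  inside-orChild (c , _ , ρ) (∧r u) side in-p with isRoot u
  ... | false with c
  ...   | false = inside-orChild ρ u side in-p
  inside-orChild (ρ , _) (∨l u) side in-p with isRoot u in isRoot-u
  ... | true rewrite isRoot-true u isRoot-u = refl
  ... | false = inside-orChild ρ u side in-p
  inside-orChild (_ , ρ) (∨r u) side in-p with isRoot u in isRoot-u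
  ... | true rewrite isRoot-true u isRoot-u = refl
  ... | false = inside-orChild ρ u side in-p

  inside-descend : ∀ {A} (ρ : ∧Choice A) (u : Node A) → inside ρ u ≡ true → inside ρ (descend ρ u) ≡ true
  inside-descend {lit _}  _           root   _ = refl
  inside-descend {_ ∧ᶠ _} (true , _)  root   _ = refl
  inside-descend {_ ∧ᶠ _} (false , _) root   _ = refl
  inside-descend {_ ∨ᶠ _} _           root   _ = refl
  inside-descend (true , ρ , _)  (∧l u) in-u = inside-descend ρ u in-u
  inside-descend (false , _ , ρ) (∧r u) in-u = inside-descend ρ u in-u
  inside-descend (ρ , _)         (∨l u) in-u = inside-descend ρ u in-u
  inside-descend (_ , ρ)         (∨r u) in-u = inside-descend ρ u in-u

  private
    map-nothing : ∀ {X Y : Set} {f : X → Y} (m : Maybe X) → Maybe.map f m ≡ nothing → m ≡ nothing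
    map-nothing nothing _ = refl

  descend-depth : ∀ {A} (ρ : ∧Choice A) (u : Node A) → leafAt u ≡ nothing → depth (descend ρ u) ≡ suc (depth u)
  descend-depth {_ ∧ᶠ _} (true , _)  root _ = refl
  descend-depth {_ ∧ᶠ _} (false , _) root _ = refl
  descend-depth {_ ∨ᶠ _} _           root _ = refl
  descend-depth (_ , ρ , _) (∧l u) internal = cong suc (descend-depth ρ u (map-nothing (leafAt u) internal))
  descend-depth (_ , _ , ρ) (∧r u) internal = cong suc (descend-depth ρ u (map-nothing (leafAt u) internal))
  descend-depth (ρ , _)     (∨l u) internal = cong suc (descend-depth ρ u (map-nothing (leafAt u) internal))
  descend-depth (_ , ρ)     (∨r u) internal = cong suc (descend-depth ρ u (map-nothing (leafAt u) internal))

  descendEdge : ∀ {A} (ρ : ∧Choice A) (τ : Node A → Bool) (u : Node A) → leafAt u ≡ nothing → τ u ≡ true →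
                TEdge A (switchingFrom A τ) u (descend ρ u)
  descendEdge {_ ∧ᶠ _} (true , _)  τ root _ _ = ∧-left
  descendEdge {_ ∧ᶠ _} (false , _) τ root _ _ = ∧-right
  descendEdge {A ∨ᶠ B} _ τ root _ τ-root =
    subst (λ b → TEdge (A ∨ᶠ B) (b , proj₂ (switchingFrom (A ∨ᶠ B) τ)) root (∨l root)) (sym τ-root) ∨-left
  descendEdge (_ , ρ , _) τ (∧l u) internal τ-u = ∧l (descendEdge ρ (λ w → τ (∧l w)) u (map-nothing (leafAt u) internal) τ-u)
  descendEdge (_ , _ , ρ) τ (∧r u) internal τ-u = ∧r (descendEdge ρ (λ w → τ (∧r w)) u (map-nothing (leafAt u) internal) τ-u)
  descendEdge (ρ , _)     τ (∨l u) internal τ-u = ∨l (descendEdge ρ (λ w → τ (∨l w)) u (map-nothing (leafAt u) internal) τ-u)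
  descendEdge (_ , ρ)     τ (∨r u) internal τ-u = ∨r (descendEdge ρ (λ w → τ (∨r w)) u (map-nothing (leafAt u) internal) τ-u)

  outside-nonRoot : ∀ {A} (ρ : ∧Choice A) (u : Node A) → inside ρ u ≡ false → isRoot u ≡ false
  outside-nonRoot _ (∧l _) _ = refl
  outside-nonRoot _ (∧r _) _ = refl
  outside-nonRoot _ (∨l _) _ = refl
  outside-nonRoot _ (∨r _) _ = refl

  private
    2+n≢n : ∀ {n} → suc (suc n) ≢ n
    2+n≢n {suc n} eq = 2+n≢n {n} (cong pred eq)

    true≢false : true ≢ false
    true≢false ()

  Escapes : ∀ {A} → AxiomLinking A → ∧Choice A → Set
  Escapes ax ρ = ∀ x → inside ρ (leafNode x) ≡ true → inside ρ (leafNode (AxiomLinking.link ax x)) ≡ false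

  module Walk {A : Formula} (ax : AxiomLinking A) (ρ : ∧Choice A) (escapes : Escapes ax ρ) where

    open AxiomLinking ax

    step : Bool → Maybe (Leaf A) → Node A → Node A
    step true  (just x) _ = leafNode (link x)
    step true  nothing  u = descend ρ u
    step false _        u = parent u

    next : Node A → Node A
    next u = step (inside ρ u) (leafAt u) u

    next-outside : ∀ u → inside ρ u ≡ false → next u ≡ parent u
    next-outside u out rewrite out = refl

    next-leaf : ∀ u {x} → inside ρ u ≡ true → leafAt u ≡ just x → next u ≡ leafNode (link x)
    next-leaf u in-u leaf rewrite in-u | leaf = refl

    next-internal : ∀ u → inside ρ u ≡ true → leafAt u ≡ nothing → next u ≡ descend ρ u
    next-internal u in-u internal rewrite in-u | internal = refl

    link-outside : ∀ u {x} → inside ρ u ≡ true → leafAt u ≡ just x → inside ρ (leafNode (link x)) ≡ false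
    link-outside u {x} in-u leaf = escapes x (subst (λ w → inside ρ w ≡ true) (leafAt-just u leaf) in-u)

    next-moves : ∀ u → next u ≢ u
    next-moves u loop with inside ρ u in in-u | leafAt u in leaf-u
    ... | true  | just x  = true≢false (trans (sym in-u) (trans (cong (inside ρ) (sym loop)) (link-outside u in-u leaf-u)))
    ... | true  | nothing = 1+n≢n (trans (sym (descend-depth ρ u leaf-u)) (cong depth loop))
    ... | false | _       = 1+n≢n (trans (parent-depth u (outside-nonRoot ρ u in-u)) (cong depth (sym loop)))

    next-no-2-cycle : ∀ u → next (next u) ≢ u
    next-no-2-cycle u loop with inside ρ u in in-u | leafAt u in leaf-u
    ... | true | just x = parentIsLeaf
      where
      w : Node A
      w = leafNode (link x)
      out-w : inside ρ w ≡ false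
      out-w = link-outside u in-u leaf-u
      parentIsLeaf : ⊥
      parentIsLeaf with trans (sym (parent-notLeaf w (outside-nonRoot ρ w out-w)))
                              (trans (cong leafAt (trans (sym (next-outside w out-w)) loop)) leaf-u)
      ... | ()
    ... | true | nothing = descended (leafAt w) refl
      where
      w : Node A
      w = descend ρ u
      in-w : inside ρ w ≡ true
      in-w = inside-descend ρ u in-u
      descended : ∀ m → leafAt w ≡ m → ⊥
      descended (just y) leaf-w =
        true≢false (trans (sym in-u) (trans (cong (inside ρ) (trans (sym loop) (next-leaf w in-w leaf-w)))
                                            (link-outside w in-w leaf-w)))
      descended nothing leaf-w =
        2+n≢n (trans (cong suc (sym (descend-depth ρ u leaf-u)))
                (trans (sym (descend-depth ρ w leaf-w)) (cong depth (trans (sym (next-internal w in-w leaf-w)) loop))))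
    ... | false | _ = climbed (inside ρ w) refl
      where
      w : Node A
      w = parent u
      internal-w : leafAt w ≡ nothing
      internal-w = parent-notLeaf u (outside-nonRoot ρ u in-u)
      climbed : ∀ b → inside ρ w ≡ b → ⊥
      climbed true in-w =
        true≢false (trans (sym (inside-descend ρ w in-w))
                     (trans (cong (inside ρ) (trans (sym (next-internal w in-w internal-w)) loop)) in-u))
      climbed false out-w =
        2+n≢n (trans (cong suc (parent-depth w (outside-nonRoot ρ w out-w)))
                (trans (parent-depth u (outside-nonRoot ρ u in-u))
                  (cong depth (sym (trans (sym (next-outside w out-w)) loop)))))

    open Iteration (_≟ᴺ_ {A}) (∈-allNodes A) next
    open import Data.List.Membership.DecPropositional (_≟ᴺ_ {A}) using (_∈?_)

    module Cycle (z : Node A) (k : ℕ) (closes : iterate (suc k) z ≡ z)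
                 (distinct : ∀ {a b} → a < suc k → b < suc k → iterate a z ≡ iterate b z → a ≡ b) where

      point : ℕ → Node A
      point a = iterate a z

      cycle : List (Node A)
      cycle = applyUpTo point (suc k)

      σ : Node A → Bool
      σ u = if inside ρ u then true else does (leftChild u ∈? cycle)

      σ-inside : ∀ u → inside ρ u ≡ true → σ u ≡ true
      σ-inside u in-u rewrite in-u = refl

      σ-outside : ∀ u → inside ρ u ≡ false → σ u ≡ does (leftChild u ∈? cycle)
      σ-outside u out-u rewrite out-u = refl

      next-injective : ∀ {u w} → u ∈ cycle → w ∈ cycle → next u ≡ next w → u ≡ w
      next-injective u∈ w∈ eq with ∈-applyUpTo⁻ point u∈ | ∈-applyUpTo⁻ point w∈
      ... | a , _ , refl | b , _ , refl = f-injectiveOnCycle {k = k} closes a b eq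

      parent-outside : ∀ u {b} → inside ρ u ≡ false → orSide u ≡ just b → inside ρ (parent u) ≡ false
      parent-outside u out-u side with inside ρ (parent u) in in-p
      ... | false = refl
      ... | true  = ⊥-elim (true≢false (trans (sym (inside-orChild ρ u side in-p)) out-u))

      leftSibling-off-cycle : ∀ {u} → u ∈ cycle → inside ρ u ≡ false → orSide u ≡ just false → leftChild (parent u) ∉ cycle
      leftSibling-off-cycle {u} u∈ out-u side w∈ with leftSibling u side
      ... | isLeft , sameParent = true≢false (just-injective (trans (sym isLeft) (trans (cong orSide w≡u) side)))
        where
        w : Node A
        w = leftChild (parent u)
        out-w : inside ρ w ≡ false
        out-w with inside ρ w in in-w
        ... | false = refl
        ... | true  = ⊥-elim (true≢false (trans (sym (inside-parent ρ w in-w))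
                                           (trans (cong (inside ρ) sameParent) (parent-outside u out-u side))))
        w≡u : w ≡ u
        w≡u = next-injective w∈ u∈ (trans (next-outside w out-w) (trans sameParent (sym (next-outside u out-u))))

      edgeToNext : ∀ u → u ∈ cycle → Adj ax (switchingFrom A σ) u (next u)
      edgeToNext u u∈ with inside ρ u in in-u | leafAt u in leaf-u
      ... | true  | just x  = inj₂ (inj₂ (x , leafAt-just u leaf-u , refl))
      ... | true  | nothing = inj₁ (descendEdge ρ σ u leaf-u (σ-inside u in-u))
      ... | false | _       = inj₂ (inj₁ (edgeFromParent A σ u (outside-nonRoot ρ u in-u) selects))
        where
        selects : ∀ {b} → orSide u ≡ just b → σ (parent u) ≡ b
        selects {true}  side = trans (σ-outside (parent u) (parent-outside u in-u side))
                                 (dec-true (leftChild (parent u) ∈? cycle)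
                                   (subst (_∈ cycle) (sym (leftChild-parent u side)) u∈))
        selects {false} side = trans (σ-outside (parent u) (parent-outside u in-u side))
                                 (dec-false (leftChild (parent u) ∈? cycle) (leftSibling-off-cycle u∈ in-u side))

      long : 3 ≤ suc k
      long = atLeast3 k closes
        where
        atLeast3 : ∀ m → iterate (suc m) z ≡ z → 3 ≤ suc m
        atLeast3 zero          loop = ⊥-elim (next-moves z loop)
        atLeast3 (suc zero)    loop = ⊥-elim (next-no-2-cycle z loop)
        atLeast3 (suc (suc _)) _    = s≤s (s≤s (s≤s z≤n))

      isCycle : IsCycle (Adj ax (switchingFrom A σ)) cycle
      isCycle = subst (3 ≤_) (sym (length-applyUpTo point (suc k))) long ,
                Unique.applyUpTo⁺₁ point (suc k) (λ a<b b<k eq → <-irrefl (distinct (<-trans a<b b<k) b<k eq) a<b) ,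
                subst (Linked (Adj ax (switchingFrom A σ)))
                  (trans (sym (applyUpTo-∷ʳ point (suc k))) (cong (λ w → cycle ++ [ w ]) closes))
                  (Linked.applyUpTo⁺₁ point (suc (suc k))
                    λ a+1<k+2 → edgeToNext _ (∈-applyUpTo⁺ point (≤-pred a+1<k+2)))

  ProofNet-¬Escapes : ∀ {A} (net : ProofNet A) (ρ : ∧Choice A) → ¬ Escapes (ProofNet.axioms net) ρ
  ProofNet-¬Escapes {A} net ρ escapes
    with Iteration.periodicPoint _≟ᴺ_ (∈-allNodes A) (Walk.next (ProofNet.axioms net) ρ escapes) root
  ... | z , k , closes , distinct = proj₂ (ProofNet.correct net (switchingFrom A C.σ)) (C.cycle , C.isCycle)
    where module C = Walk.Cycle (ProofNet.axioms net) ρ escapes z k closes distinct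

  refutingChoice : Valuation → ∀ A → ∧Choice A
  refutingChoice v (lit _)  = tt
  refutingChoice v (A ∧ᶠ B) = not (eval v A) , refutingChoice v A , refutingChoice v B
  refutingChoice v (A ∨ᶠ B) = refutingChoice v A , refutingChoice v B

  refutingChoice-false : ∀ v A → eval v A ≡ false → ∀ x → inside (refutingChoice v A) (leafNode x) ≡ true →
                         evalLit v (label x) ≡ false
  refutingChoice-false v (lit _)  A-false here   _    = A-false
  refutingChoice-false v (A ∧ᶠ B) _       (∧l x) in-x with eval v A in A-false
  ... | false = refutingChoice-false v A A-false x in-x
  refutingChoice-false v (A ∧ᶠ B) B-false (∧r x) in-x with eval v A
  ... | true = refutingChoice-false v B B-false x in-x
  refutingChoice-false v (A ∨ᶠ B) A∨B-false (∨l x) in-x =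
    refutingChoice-false v A (∨-falseˡ A∨B-false) x in-x
    where
    ∨-falseˡ : ∀ {a b} → a Data.Bool.∨ b ≡ false → a ≡ false
    ∨-falseˡ {false} _ = refl
  refutingChoice-false v (A ∨ᶠ B) A∨B-false (∨r x) in-x with eval v A
  ... | false = refutingChoice-false v B A∨B-false x in-x

  evalLit-dual : ∀ v l → evalLit v (dual l) ≡ not (evalLit v l)
  evalLit-dual v (mkLit x true)  = refl
  evalLit-dual v (mkLit x false) = sym (not-involutive (v x))

  ProofNet-valid : ∀ {A} → ProofNet A → Valid A
  ProofNet-valid {A} net v with eval v A in A-false
  ... | true  = refl
  ... | false = ⊥-elim (ProofNet-¬Escapes net ρ escapes)
    where
    open AxiomLinking (ProofNet.axioms net)
    ρ : ∧Choice A
    ρ = refutingChoice v A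
    escapes : Escapes (ProofNet.axioms net) ρ
    escapes x in-x with inside ρ (leafNode (link x)) in in-y
    ... | false = refl
    ... | true  = ⊥-elim (true≢false (begin
      true                                ≡⟨ cong not (refutingChoice-false v A A-false x in-x) ⟨
      not (evalLit v (label x))           ≡⟨ evalLit-dual v (label x) ⟨
      evalLit v (dual (label x))          ≡⟨ cong (evalLit v) (dualLabel x) ⟨
      evalLit v (label (link x))          ≡⟨ refutingChoice-false v A A-false (link x) in-y ⟩
      false                               ∎))
      where open ≡-Reasoning

open CliqueMaps using (CliqueMap-valid)
open Soundness using (ProofNet-valid)
open Completeness using (completeness)

mainTheorem1 : ∀ (A : Formula) → Valid A ⇔ CombinatorialProof A
mainTheorem1 A = mk⇔ (completeness A) λ { (_ , net , map) → CliqueMap-valid map (ProofNet-valid net) }
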